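{- For every integer $n\ge 0$, the following identity of polynomials in $x$ holds: \begin{multline*} \sum_{k=0}^{n}B_{k}(x)B_{n-k}(x)=\sum_{k=0}^{n}\left(2^{k+2}k+2^{k+1}\right)\Biggl[\frac{2}{n+2}\sum_{l=0}^{n-2}\sum_{\substack{0\le j\le l\\ j-k\equiv 0 \pmod 2}}B_{n-l}B_{l-j}\frac{\binom{n+2}{l}\binom{l}{j}\,j!\left(\frac{j+k+2}{2}\right)!}{\left(\frac{j-k}{2}\right)!\,(j+k+2)!}\\ +(n+1)\sum_{\substack{0\le l\le n\\ l-k\equiv 0 \pmod 2}}\binom{n}{l}B_{n-l}\frac{l!\left(\frac{l+k+2}{2}\right)!}{\left(\frac{l-k}{2}\right)!\,(l+k+2)!}\Biggr]P_{k}(x), \end{multline*} where the sum over $l$ from $0$ to $n-2$ is empty when $n<2$.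
   Context: $P_k(x)$ denotes the $k$-th Legendre polynomial, defined by $\frac{1}{\sqrt{1-2xt+t^2}}=\sum_{k\ge 0}P_k(x)t^k$ (equivalently $P_k(x)=\frac{1}{k!2^k}\frac{d^k}{dx^k}(x^2-1)^k$). The Bernoulli polynomials $B_n(x)$ are defined by $\frac{t}{e^t-1}e^{xt}=\sum_{n\ge0}B_n(x)\frac{t^n}{n!}$, and $B_m:=B_m(0)$ denotes the $m$-th Bernoulli number. Convention: terms with $j<k$ (resp. $l<k$) are taken to be $0$, i.e. $1/m!=0$ for negative integers $m$. -}

module Defs where

open import Data.Nat as ℕ using (ℕ; zero; suc; _∸_; _≤ᵇ_; _!; _%_)
import Data.Nat.DivMod
open import Data.Nat.Combinatorics using (_C_)
open import Data.Integer using (+_)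
open import Data.Rational using (ℚ; 0ℚ; 1ℚ; _+_; _*_; -_; _/_)
open import Data.Bool using (if_then_else_)

ι : ℕ → ℚ
ι n = + n / 1

-- a / d as a rational, for d ≥ 1 (all uses below have positive d; d = 0 gives 0)
frac : ℕ → ℕ → ℚ
frac a zero    = 0ℚ
frac a (suc d) = + a / suc d

Σ< : ℕ → (ℕ → ℚ) → ℚ
Σ< zero    f = 0ℚ
Σ< (suc m) f = Σ< m f + f m

_^ℚ_ : ℚ → ℕ → ℚ
x ^ℚ zero  = 1ℚ
x ^ℚ suc n = (x ^ℚ n) * x

-- Bernoulli numbers (convention B₁ = -1/2, from t/(eᵗ-1)), via the standard
-- recurrence  Σ_{k=0}^{m} C(m+1,k) B_k = 0  (m ≥ 1), B₀ = 1.
-- bernTab m k = B_k for k ≤ m.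
bernTab : ℕ → ℕ → ℚ
bernTab zero    k = 1ℚ
bernTab (suc m) k =
  if k ≤ᵇ m then bernTab m k
  else - (frac 1 (m ℕ.+ 2) * Σ< (suc m) (λ i → ι ((m ℕ.+ 2) C i) * bernTab m i))

B : ℕ → ℚ
B m = bernTab m m

Bpoly : ℕ → ℚ → ℚ
Bpoly n x = Σ< (suc n) (λ k → ι (n C k) * B k * (x ^ℚ (n ∸ k)))

-- Legendre polynomials (expanded Rodrigues formula):
-- P_k(x) = 2^{-k} Σ_{j=0}^{⌊k/2⌋} (-1)^j C(k,j) C(2k-2j,k) x^{k-2j}
P : ℕ → ℚ → ℚ
P k x = frac 1 (2 ℕ.^ k) *
  Σ< (suc (k ℕ./ 2)) (λ j →
    ((- 1ℚ) ^ℚ j) * ι ((k C j) ℕ.* ((2 ℕ.* k ∸ 2 ℕ.* j) C k)) * (x ^ℚ (k ∸ 2 ℕ.* j)))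

-- F(j,k) = j! ((j+k+2)/2)! / ( ((j-k)/2)! (j+k+2)! )  when j ≥ k and j ≡ k (mod 2);
-- 0 otherwise (convention 1/m! = 0 for negative m, and the parity restriction).
F : ℕ → ℕ → ℚ
F j k =
  if (k ≤ᵇ j) Data.Bool.∧ (((j ∸ k) % 2) ℕ.≡ᵇ 0)
  then frac ((j !) ℕ.* (((j ℕ.+ k ℕ.+ 2) ℕ./ 2) !))
            ((((j ∸ k) ℕ./ 2) !) ℕ.* ((j ℕ.+ k ℕ.+ 2) !))
  else 0ℚ

LHS : ℕ → ℚ → ℚ
LHS n x = Σ< (suc n) (λ k → Bpoly k x * Bpoly (n ∸ k) x)

coeff : ℕ → ℕ → ℚ
coeff n k =
    frac 2 (n ℕ.+ 2) *
      Σ< (n ∸ 1) (λ l →          -- l = 0 … n-2 (empty if n < 2)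
        Σ< (suc l) (λ j →
          B (n ∸ l) * B (l ∸ j) * ι (((n ℕ.+ 2) C l) ℕ.* (l C j)) * F j k))
  + ι (suc n) *
      Σ< (suc n) (λ l →
        ι (n C l) * B (n ∸ l) * F l k)

RHS : ℕ → ℚ → ℚ
RHS n x = Σ< (suc n) (λ k →
  ι ((2 ℕ.^ (k ℕ.+ 2)) ℕ.* k ℕ.+ 2 ℕ.^ (k ℕ.+ 1)) * coeff n k * P k x)

-- Both sides are polynomials in x of degree ≤ n, handled as coefficient sequences.  The left side
-- satisfies the convolution identity
--   Σₖ Bₖ Bₙ₋ₖ = 2/(n+2) Σ_{l ≤ n−2} C(n+2,l) Bₙ₋ₗ Bₗ + (n+1) Bₙ,
-- proved coefficientwise by induction on n: the Appell property B′ₖ = k Bₖ₋₁ makes both sides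
-- satisfy p′ₙ₊₁ = (n+2) pₙ, which settles every coefficient but the constant one, and the constant
-- terms agree because both sides have integral 2Bₙ/(n+2) over [0,1] (integration by parts on the
-- left, ∫₀¹ Bₗ = 0 for l ≥ 1 on the right).  The right side of the theorem is the expansion of this
-- polynomial in Legendre polynomials, using xʲ = Σₖ (2ᵏ⁺²k + 2ᵏ⁺¹) F(j,k) Pₖ(x).  That expansion
-- follows by induction on j from Bonnet's recurrence (k+1)Pₖ₊₁ + kPₖ₋₁ = (2k+1)xPₖ, read off the
-- explicit coefficients of Pₖ, and the matching recurrence 2(2k+1)F(j+1,k) = kF(j,k−1) + 4(k+1)F(j,k+1),
-- which in turn follows from two first-order relations between neighbouring values of F.

module Submission where

open import Defs
open import Data.Bool using (true; false; if_then_else_)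
open import Data.Bool.Properties using (T-≡)
open import Data.Empty using (⊥-elim)
import Data.Integer as ℤ
import Data.Integer.Properties as ℤP
open import Data.Nat as ℕ using (ℕ; zero; suc; _∸_; _!; z≤n; s≤s)
open import Data.Nat.Combinatorics using (_C_; nCk≡nC[n∸k]; nC1≡n; nCn≡1; k>n⇒nCk≡0; nCk≡n!/k![n-k]!; k![n∸k]!∣n!)
open import Data.Nat.DivMod using (m/n*n≡m; m*n%n≡0; m*n/n≡m; [m+kn]%n≡m%n; m≡m%n+[m/n]*n; m%n<n; m/n≤m)
import Data.Nat.Properties as ℕP
open import Data.Nat.Tactic.RingSolver using (solve-∀)
open import Data.Product using (Σ; _,_; proj₁; proj₂)
open import Data.Rational as ℚ using (ℚ; 0ℚ; 1ℚ; _+_; _*_; -_; _-_; _≟_)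
open import Data.Rational.Properties using (+-identityˡ; +-identityʳ; *-identityˡ; *-identityʳ; *-zeroˡ; *-zeroʳ; *-assoc; *-comm; +-comm; +-assoc; *-distribˡ-+; *-distribʳ-+; +-inverseʳ)
import Data.Rational.Properties as ℚP
open import Algebra.Properties.Group ℚP.+-0-group using () renaming (∙-cancelʳ to +-cancelʳ)
import Data.Rational.Unnormalised as ℚᵘ
import Data.Rational.Unnormalised.Properties as ℚᵘP
open import Data.Sum using (_⊎_; inj₁; inj₂; [_,_]′)
open import Function.Bundles using (Equivalence)
open import Level using (0ℓ)
open import Relation.Binary.PropositionalEquality
open import Relation.Nullary using (yes; no)
open import Relation.Nullary.Decidable using (dec⇒maybe)
open import Tactic.RingSolver using () renaming (solve-∀ to ring-solve-∀)
open import Tactic.RingSolver.Core.AlmostCommutativeRing using (AlmostCommutativeRing; fromCommutativeRing)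
open ≡-Reasoning

ℚ-ring : AlmostCommutativeRing 0ℓ 0ℓ
ℚ-ring = fromCommutativeRing ℚP.+-*-commutativeRing (λ x → dec⇒maybe (0ℚ ≟ x))


fromℚᵘ-homo-+ : ∀ p q → ℚ.fromℚᵘ (p ℚᵘ.+ q) ≡ ℚ.fromℚᵘ p + ℚ.fromℚᵘ q
fromℚᵘ-homo-+ p q = ℚP.toℚᵘ-injective
  (ℚᵘP.≃-trans (ℚP.toℚᵘ-fromℚᵘ (p ℚᵘ.+ q))
  (ℚᵘP.≃-sym (ℚᵘP.≃-trans (ℚP.toℚᵘ-homo-+ (ℚ.fromℚᵘ p) (ℚ.fromℚᵘ q))
    (ℚᵘP.+-cong (ℚP.toℚᵘ-fromℚᵘ p) (ℚP.toℚᵘ-fromℚᵘ q)))))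

fromℚᵘ-homo-* : ∀ p q → ℚ.fromℚᵘ (p ℚᵘ.* q) ≡ ℚ.fromℚᵘ p * ℚ.fromℚᵘ q
fromℚᵘ-homo-* p q = ℚP.toℚᵘ-injective
  (ℚᵘP.≃-trans (ℚP.toℚᵘ-fromℚᵘ (p ℚᵘ.* q))
  (ℚᵘP.≃-sym (ℚᵘP.≃-trans (ℚP.toℚᵘ-homo-* (ℚ.fromℚᵘ p) (ℚ.fromℚᵘ q))
    (ℚᵘP.*-cong (ℚP.toℚᵘ-fromℚᵘ p) (ℚP.toℚᵘ-fromℚᵘ q)))))

-- frac a (suc d) is definitionally ℚ.fromℚᵘ (ℚᵘ.mkℚᵘ (ℤ.+ a) d).
frac-cong : ∀ a b c d → a ℕ.* suc d ≡ c ℕ.* suc b → frac a (suc b) ≡ frac c (suc d)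
frac-cong a b c d eq = ℚP.fromℚᵘ-cong {ℚᵘ.mkℚᵘ (ℤ.+ a) b} {ℚᵘ.mkℚᵘ (ℤ.+ c) d} (ℚᵘ.*≡* (begin
  ℤ.+ a ℤ.* ℤ.+ suc d   ≡⟨ ℤP.pos-* a (suc d) ⟨
  ℤ.+ (a ℕ.* suc d)     ≡⟨ cong ℤ.+_ eq ⟩
  ℤ.+ (c ℕ.* suc b)     ≡⟨ ℤP.pos-* c (suc b) ⟩
  ℤ.+ c ℤ.* ℤ.+ suc b   ∎))

frac-*-frac : ∀ a b c d → frac a (suc b) * frac c (suc d) ≡ frac (a ℕ.* c) (suc b ℕ.* suc d)
frac-*-frac a b c d = begin
  frac a (suc b) * frac c (suc d)    ≡⟨ fromℚᵘ-homo-* p q ⟨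
  ℚ.fromℚᵘ (p ℚᵘ.* q)                ≡⟨ ℚP.fromℚᵘ-cong {r} {p ℚᵘ.* q} (ℚᵘ.*≡* (cong (ℤ._* ℤ.+ (suc b ℕ.* suc d)) (ℤP.pos-* a c))) ⟨
  frac (a ℕ.* c) (suc b ℕ.* suc d)   ∎
  where
  p = ℚᵘ.mkℚᵘ (ℤ.+ a) b
  q = ℚᵘ.mkℚᵘ (ℤ.+ c) d
  r = ℚᵘ.mkℚᵘ (ℤ.+ (a ℕ.* c)) (d ℕ.+ b ℕ.* suc d)

frac-+-frac : ∀ a b c d →
  frac a (suc b) + frac c (suc d) ≡ frac (a ℕ.* suc d ℕ.+ c ℕ.* suc b) (suc b ℕ.* suc d)
frac-+-frac a b c d = begin
  frac a (suc b) + frac c (suc d)                        ≡⟨ fromℚᵘ-homo-+ p q ⟨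
  ℚ.fromℚᵘ (p ℚᵘ.+ q)                                    ≡⟨ ℚP.fromℚᵘ-cong {p ℚᵘ.+ q} {r} (ℚᵘ.*≡* (cong (ℤ._* ℤ.+ (suc b ℕ.* suc d)) numerator)) ⟩
  frac (a ℕ.* suc d ℕ.+ c ℕ.* suc b) (suc b ℕ.* suc d)   ∎
  where
  p = ℚᵘ.mkℚᵘ (ℤ.+ a) b
  q = ℚᵘ.mkℚᵘ (ℤ.+ c) d
  r = ℚᵘ.mkℚᵘ (ℤ.+ (a ℕ.* suc d ℕ.+ c ℕ.* suc b)) (d ℕ.+ b ℕ.* suc d)
  numerator : ℤ.+ a ℤ.* ℤ.+ suc d ℤ.+ ℤ.+ c ℤ.* ℤ.+ suc b ≡ ℤ.+ (a ℕ.* suc d ℕ.+ c ℕ.* suc b)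
  numerator = begin
    ℤ.+ a ℤ.* ℤ.+ suc d ℤ.+ ℤ.+ c ℤ.* ℤ.+ suc b  ≡⟨ cong₂ ℤ._+_ (ℤP.pos-* a (suc d)) (ℤP.pos-* c (suc b)) ⟨
    ℤ.+ (a ℕ.* suc d) ℤ.+ ℤ.+ (c ℕ.* suc b)      ≡⟨ ℤP.pos-+ (a ℕ.* suc d) (c ℕ.* suc b) ⟨
    ℤ.+ (a ℕ.* suc d ℕ.+ c ℕ.* suc b)            ∎

ι-homo-+ : ∀ m n → ι (m ℕ.+ n) ≡ ι m + ι n
ι-homo-+ m n = trans (frac-cong (m ℕ.+ n) 0 (m ℕ.* 1 ℕ.+ n ℕ.* 1) 0 (eq m n)) (sym (frac-+-frac m 0 n 0))
  where
  eq : ∀ m n → (m ℕ.+ n) ℕ.* 1 ≡ (m ℕ.* 1 ℕ.+ n ℕ.* 1) ℕ.* 1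
  eq = solve-∀

ι-homo-* : ∀ m n → ι (m ℕ.* n) ≡ ι m * ι n
ι-homo-* m n = sym (frac-*-frac m 0 n 0)

ι-homo-*₃ : ∀ a b c → ι (a ℕ.* b ℕ.* c) ≡ ι a * ι b * ι c
ι-homo-*₃ a b c = trans (ι-homo-* (a ℕ.* b) c) (cong (_* ι c) (ι-homo-* a b))

frac-*-ι : ∀ a d .{{_ : ℕ.NonZero d}} → frac a d * ι d ≡ ι a
frac-*-ι a d = subst (λ e → frac a e * ι e ≡ ι a) (ℕP.suc-pred d) (frac-*-ι-suc (ℕ.pred d))
  where
  frac-*-ι-suc : ∀ e → frac a (suc e) * ι (suc e) ≡ ι a
  frac-*-ι-suc e = trans (frac-*-frac a e (suc e) 0) (frac-cong (a ℕ.* suc e) (e ℕ.* 1) a 0 (eq a e))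
    where
    eq : ∀ a e → a ℕ.* suc e ℕ.* 1 ≡ a ℕ.* suc (e ℕ.* 1)
    eq = solve-∀

*ι-cancelʳ : ∀ d .{{_ : ℕ.NonZero d}} {p q} → p * ι d ≡ q * ι d → p ≡ q
*ι-cancelʳ d {p} {q} eq = begin
  p                   ≡⟨ undo p ⟨
  p * ι d * frac 1 d  ≡⟨ cong (_* frac 1 d) eq ⟩
  q * ι d * frac 1 d  ≡⟨ undo q ⟩
  q                   ∎
  where
  undo : ∀ r → r * ι d * frac 1 d ≡ r
  undo r = begin
    r * ι d * frac 1 d    ≡⟨ *-assoc r (ι d) (frac 1 d) ⟩
    r * (ι d * frac 1 d)  ≡⟨ cong (r *_) (trans (*-comm (ι d) (frac 1 d)) (frac-*-ι 1 d)) ⟩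
    r * 1ℚ                ≡⟨ *-identityʳ r ⟩
    r                     ∎

-- Finite sums

Σ<-cong : ∀ m {f g : ℕ → ℚ} → (∀ i → i ℕ.< m → f i ≡ g i) → Σ< m f ≡ Σ< m g
Σ<-cong zero    f≡g = refl
Σ<-cong (suc m) f≡g = cong₂ _+_ (Σ<-cong m (λ i i<m → f≡g i (ℕP.m<n⇒m<1+n i<m))) (f≡g m ℕP.≤-refl)

Σ<-cong′ : ∀ m {f g : ℕ → ℚ} → (∀ i → f i ≡ g i) → Σ< m f ≡ Σ< m g
Σ<-cong′ m f≡g = Σ<-cong m (λ i _ → f≡g i)

Σ<-zero : ∀ m {f : ℕ → ℚ} → (∀ i → i ℕ.< m → f i ≡ 0ℚ) → Σ< m f ≡ 0ℚ
Σ<-zero zero    f≡0 = refl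
Σ<-zero (suc m) f≡0 = cong₂ _+_ (Σ<-zero m (λ i i<m → f≡0 i (ℕP.m<n⇒m<1+n i<m))) (f≡0 m ℕP.≤-refl)

Σ<-distrib-+ : ∀ m (f g : ℕ → ℚ) → Σ< m (λ i → f i + g i) ≡ Σ< m f + Σ< m g
Σ<-distrib-+ zero    f g = refl
Σ<-distrib-+ (suc m) f g = trans (cong (_+ (f m + g m)) (Σ<-distrib-+ m f g)) (swap (Σ< m f) (Σ< m g) (f m) (g m))
  where
  swap : ∀ a b c d → a + b + (c + d) ≡ a + c + (b + d)
  swap = ring-solve-∀ ℚ-ring

*-distribˡ-Σ< : ∀ m c (f : ℕ → ℚ) → c * Σ< m f ≡ Σ< m (λ i → c * f i)
*-distribˡ-Σ< zero    c f = *-zeroʳ c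
*-distribˡ-Σ< (suc m) c f = trans (*-distribˡ-+ c (Σ< m f) (f m)) (cong (_+ c * f m) (*-distribˡ-Σ< m c f))

*-distribʳ-Σ< : ∀ m c (f : ℕ → ℚ) → Σ< m f * c ≡ Σ< m (λ i → f i * c)
*-distribʳ-Σ< m c f = trans (*-comm (Σ< m f) c) (trans (*-distribˡ-Σ< m c f) (Σ<-cong′ m (λ i → *-comm c (f i))))

Σ<-head : ∀ m (f : ℕ → ℚ) → Σ< (suc m) f ≡ f 0 + Σ< m (λ i → f (suc i))
Σ<-head zero    f = trans (+-identityˡ (f 0)) (sym (+-identityʳ (f 0)))
Σ<-head (suc m) f = trans (cong (_+ f (suc m)) (Σ<-head m f)) (+-assoc (f 0) _ _)

Σ<-shift : ∀ n (f g : ℕ → ℚ) → f 0 ≡ 0ℚ → (∀ k → f (suc k) ≡ g k) → g n ≡ 0ℚ → Σ< (suc n) f ≡ Σ< (suc n) g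
Σ<-shift n f g f₀≡0 f∘suc≡g gₙ≡0 = begin
  Σ< (suc n) f                         ≡⟨ Σ<-head n f ⟩
  f 0 + Σ< n (λ k → f (suc k))         ≡⟨ cong₂ _+_ f₀≡0 (Σ<-cong′ n f∘suc≡g) ⟩
  0ℚ + Σ< n g                          ≡⟨ +-comm 0ℚ (Σ< n g) ⟩
  Σ< n g + 0ℚ                          ≡⟨ cong (Σ< n g +_) gₙ≡0 ⟨
  Σ< (suc n) g                         ∎

Σ<-swap : ∀ m n (f : ℕ → ℕ → ℚ) → Σ< m (λ i → Σ< n (f i)) ≡ Σ< n (λ j → Σ< m (λ i → f i j))
Σ<-swap zero    n f = sym (Σ<-zero n (λ _ _ → refl))
Σ<-swap (suc m) n f = trans (cong (_+ Σ< n (f m)) (Σ<-swap m n f)) (sym (Σ<-distrib-+ n _ (f m)))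

Σ<-truncate : ∀ m M (f : ℕ → ℚ) → m ℕ.≤ M → (∀ i → m ℕ.≤ i → f i ≡ 0ℚ) → Σ< M f ≡ Σ< m f
Σ<-truncate m M f m≤M f≡0 = subst (λ M → Σ< M f ≡ Σ< m f) (ℕP.m∸n+n≡m m≤M) (pad (M ∸ m))
  where
  pad : ∀ k → Σ< (k ℕ.+ m) f ≡ Σ< m f
  pad zero    = refl
  pad (suc k) = trans (cong (Σ< (k ℕ.+ m) f +_) (f≡0 (k ℕ.+ m) (ℕP.m≤n+m m k))) (trans (+-identityʳ _) (pad k))

Σ<-reverse : ∀ n (f : ℕ → ℚ) → Σ< (suc n) f ≡ Σ< (suc n) (λ i → f (n ∸ i))
Σ<-reverse zero    f = refl
Σ<-reverse (suc n) f = begin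
  Σ< (suc n) f + f (suc n)                      ≡⟨ cong (_+ f (suc n)) (Σ<-reverse n f) ⟩
  Σ< (suc n) (λ i → f (n ∸ i)) + f (suc n)      ≡⟨ +-comm _ (f (suc n)) ⟩
  f (suc n) + Σ< (suc n) (λ i → f (n ∸ i))      ≡⟨ Σ<-head (suc n) (λ i → f (suc n ∸ i)) ⟨
  Σ< (suc (suc n)) (λ i → f (suc n ∸ i))        ∎

Σ<-triangle : ∀ N (f : ℕ → ℕ → ℚ) →
  Σ< N (λ i → Σ< (suc i) (λ a → f a (i ∸ a))) ≡ Σ< N (λ a → Σ< (N ∸ a) (f a))
Σ<-triangle zero    f = refl
Σ<-triangle (suc N) f = begin
  Σ< N (λ i → Σ< (suc i) (λ a → f a (i ∸ a))) + Σ< (suc N) (λ a → f a (N ∸ a))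
    ≡⟨ cong (_+ Σ< (suc N) (λ a → f a (N ∸ a))) (Σ<-triangle N f) ⟩
  Σ< N (λ a → Σ< (N ∸ a) (f a)) + Σ< (suc N) (λ a → f a (N ∸ a))
    ≡⟨ cong (_+ Σ< (suc N) (λ a → f a (N ∸ a))) lastEmpty ⟨
  Σ< (suc N) (λ a → Σ< (N ∸ a) (f a)) + Σ< (suc N) (λ a → f a (N ∸ a))
    ≡⟨ Σ<-distrib-+ (suc N) _ _ ⟨
  Σ< (suc N) (λ a → Σ< (N ∸ a) (f a) + f a (N ∸ a))
    ≡⟨ Σ<-cong (suc N) (λ a a≤N → cong (λ k → Σ< k (f a)) (sym (ℕP.+-∸-assoc 1 (ℕP.≤-pred a≤N)))) ⟩
  Σ< (suc N) (λ a → Σ< (suc N ∸ a) (f a)) ∎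
  where
  lastEmpty : Σ< (suc N) (λ a → Σ< (N ∸ a) (f a)) ≡ Σ< N (λ a → Σ< (N ∸ a) (f a))
  lastEmpty = trans (cong (λ k → Σ< N (λ a → Σ< (N ∸ a) (f a)) + Σ< k (f N)) (ℕP.n∸n≡0 N)) (+-identityʳ _)

-- Polynomials as coefficient sequences

Poly : Set
Poly = ℕ → ℚ

Deg< : ℕ → Poly → Set
Deg< d p = ∀ i → d ℕ.≤ i → p i ≡ 0ℚ

𝟙 : Poly
𝟙 zero    = 1ℚ
𝟙 (suc i) = 0ℚ

_⊗_ : Poly → Poly → Poly
(p ⊗ q) i = Σ< (suc i) (λ a → p a * q (i ∸ a))

∂ : Poly → Poly
∂ p i = ι (suc i) * p (suc i)

-- Pairing the first N coefficients with weights wᵢ: evaluation at x takes wᵢ = xⁱ,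
-- integration over [0, 1] takes wᵢ = 1/(i+1).
pairing : ℕ → Poly → (ℕ → ℚ) → ℚ
pairing N p w = Σ< N (λ i → p i * w i)

eval : ℕ → Poly → ℚ → ℚ
eval N p x = pairing N p (x ^ℚ_)

∫₀¹ : ℕ → Poly → ℚ
∫₀¹ N p = pairing N p (λ i → frac 1 (suc i))

pairing-cong : ∀ N {p q} w → (∀ i → p i ≡ q i) → pairing N p w ≡ pairing N q w
pairing-cong N w p≡q = Σ<-cong′ N (λ i → cong (_* w i) (p≡q i))

pairing-scale : ∀ N a p w → pairing N (λ i → a * p i) w ≡ a * pairing N p w
pairing-scale N a p w = trans (Σ<-cong′ N (λ i → *-assoc a (p i) (w i))) (sym (*-distribˡ-Σ< N a _))

pairing-linear : ∀ N a b p q w →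
  pairing N (λ i → a * p i + b * q i) w ≡ a * pairing N p w + b * pairing N q w
pairing-linear N a b p q w = begin
  pairing N (λ i → a * p i + b * q i) w
    ≡⟨ trans (Σ<-cong′ N (λ i → *-distribʳ-+ (w i) (a * p i) (b * q i))) (Σ<-distrib-+ N _ _) ⟩
  Σ< N (λ i → a * p i * w i) + Σ< N (λ i → b * q i * w i)
    ≡⟨ cong₂ _+_ (pairing-scale N a p w) (pairing-scale N b q w) ⟩
  a * pairing N p w + b * pairing N q w ∎

pairing-Σ< : ∀ N K (p : ℕ → Poly) w →
  pairing N (λ i → Σ< K (λ k → p k i)) w ≡ Σ< K (λ k → pairing N (p k) w)
pairing-Σ< N K p w = trans (Σ<-cong′ N (λ i → *-distribʳ-Σ< K (w i) (λ k → p k i))) (Σ<-swap N K _)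

pairing-truncate : ∀ m M p w → m ℕ.≤ M → Deg< m p → pairing M p w ≡ pairing m p w
pairing-truncate m M p w m≤M deg =
  Σ<-truncate m M _ m≤M (λ i m≤i → trans (cong (_* w i) (deg i m≤i)) (*-zeroˡ (w i)))

^ℚ-distribˡ-+-* : ∀ x a b → x ^ℚ (a ℕ.+ b) ≡ x ^ℚ a * x ^ℚ b
^ℚ-distribˡ-+-* x a zero    = trans (cong (x ^ℚ_) (ℕP.+-identityʳ a)) (sym (*-identityʳ _))
^ℚ-distribˡ-+-* x a (suc b) = begin
  x ^ℚ (a ℕ.+ suc b)      ≡⟨ cong (x ^ℚ_) (ℕP.+-suc a b) ⟩
  x ^ℚ (a ℕ.+ b) * x      ≡⟨ cong (_* x) (^ℚ-distribˡ-+-* x a b) ⟩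
  x ^ℚ a * x ^ℚ b * x     ≡⟨ *-assoc (x ^ℚ a) _ _ ⟩
  x ^ℚ a * x ^ℚ suc b     ∎

1^ℚn≡1 : ∀ n → 1ℚ ^ℚ n ≡ 1ℚ
1^ℚn≡1 zero    = refl
1^ℚn≡1 (suc n) = trans (*-identityʳ _) (1^ℚn≡1 n)

eval-1 : ∀ N p → eval N p 1ℚ ≡ Σ< N p
eval-1 N p = Σ<-cong′ N (λ i → trans (cong (p i *_) (1^ℚn≡1 i)) (*-identityʳ (p i)))

⊗-at-0 : ∀ p q → (p ⊗ q) 0 ≡ p 0 * q 0
⊗-at-0 p q = +-identityˡ _

⊗-comm : ∀ p q i → (p ⊗ q) i ≡ (q ⊗ p) i
⊗-comm p q i = trans (Σ<-reverse i _) (Σ<-cong (suc i) (λ a a≤i →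
  trans (*-comm (p (i ∸ a)) _) (cong (λ b → q b * p (i ∸ a)) (ℕP.m∸[m∸n]≡n (ℕP.≤-pred a≤i)))))

⊗-identityˡ : ∀ {e} q → (∀ i → e i ≡ 𝟙 i) → ∀ i → (e ⊗ q) i ≡ q i
⊗-identityˡ {e} q e≡𝟙 i = begin
  Σ< (suc i) (λ a → e a * q (i ∸ a))                       ≡⟨ Σ<-cong′ (suc i) (λ a → cong (_* q (i ∸ a)) (e≡𝟙 a)) ⟩
  Σ< (suc i) (λ a → 𝟙 a * q (i ∸ a))                       ≡⟨ Σ<-head i _ ⟩
  1ℚ * q i + Σ< i (λ a → 0ℚ * q (i ∸ suc a))               ≡⟨ cong₂ _+_ (*-identityˡ (q i)) (Σ<-zero i (λ a _ → *-zeroˡ (q (i ∸ suc a)))) ⟩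
  q i + 0ℚ                                                ≡⟨ +-identityʳ (q i) ⟩
  q i                                                     ∎

⊗-identityʳ : ∀ {e} q → (∀ i → e i ≡ 𝟙 i) → ∀ i → (q ⊗ e) i ≡ q i
⊗-identityʳ {e} q e≡𝟙 i = trans (⊗-comm q e i) (⊗-identityˡ q e≡𝟙 i)

⊗-scaleˡ : ∀ c {p p′} q → (∀ i → p i ≡ c * p′ i) → ∀ i → (p ⊗ q) i ≡ c * (p′ ⊗ q) i
⊗-scaleˡ c q p≡cp′ i = trans (Σ<-cong′ (suc i) (λ a → trans (cong (_* q (i ∸ a)) (p≡cp′ a)) (*-assoc c _ _)))
  (sym (*-distribˡ-Σ< (suc i) c _))

⊗-scaleʳ : ∀ c p {q q′} → (∀ i → q i ≡ c * q′ i) → ∀ i → (p ⊗ q) i ≡ c * (p ⊗ q′) i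
⊗-scaleʳ c p q≡cq′ i = trans (Σ<-cong′ (suc i) (λ a → trans (cong (p a *_) (q≡cq′ (i ∸ a))) (swap (p a) c _)))
  (sym (*-distribˡ-Σ< (suc i) c _))
  where
  swap : ∀ u v w → u * (v * w) ≡ v * (u * w)
  swap = ring-solve-∀ ℚ-ring

m≤n∧n+o<p⇒o<p∸m : ∀ {m n o p} → m ℕ.≤ n → suc (n ℕ.+ o) ℕ.≤ p → suc o ℕ.≤ p ∸ m
m≤n∧n+o<p⇒o<p∸m {m} {n} {o} {p} m≤n n+o<p =
  ℕP.≤-trans (ℕP.≤-reflexive eq) (ℕP.≤-trans (ℕP.∸-monoˡ-≤ n n+o<p) (ℕP.∸-monoʳ-≤ p m≤n))
  where
  eq : suc o ≡ suc (n ℕ.+ o) ∸ n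
  eq = sym (trans (cong (_∸ n) (sym (ℕP.+-suc n o))) (ℕP.m+n∸m≡n n (suc o)))

⊗-Deg< : ∀ d e {p q} → Deg< (suc d) p → Deg< (suc e) q → Deg< (suc (d ℕ.+ e)) (p ⊗ q)
⊗-Deg< d e {p} {q} degp degq i d+e<i = Σ<-zero (suc i) term
  where
  term : ∀ a → a ℕ.< suc i → p a * q (i ∸ a) ≡ 0ℚ
  term a _ with suc d ℕ.≤? a
  ... | yes d<a = trans (cong (_* q (i ∸ a)) (degp a d<a)) (*-zeroˡ (q (i ∸ a)))
  ... | no  d≮a = trans (cong (p a *_) (degq (i ∸ a) (m≤n∧n+o<p⇒o<p∸m (ℕP.≤-pred (ℕP.≰⇒> d≮a)) d+e<i))) (*-zeroʳ (p a))

eval-⊗ : ∀ d e n {p q} x → Deg< (suc d) p → Deg< (suc e) q → d ℕ.+ e ℕ.≤ n →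
  eval (suc n) (p ⊗ q) x ≡ eval (suc d) p x * eval (suc e) q x
eval-⊗ d e n {p} {q} x degp degq d+e≤n = begin
  eval (suc n) (p ⊗ q) x                                        ≡⟨ pairing-truncate (suc (d ℕ.+ e)) (suc n) _ _ (s≤s d+e≤n) degpq ⟩
  eval (suc (d ℕ.+ e)) (p ⊗ q) x                                ≡⟨ pairing-truncate (suc (d ℕ.+ e)) N _ _ d+e<N degpq ⟨
  eval N (p ⊗ q) x                                              ≡⟨ Σ<-cong′ N expand ⟩
  Σ< N (λ i → Σ< (suc i) (λ a → g a (i ∸ a)))                   ≡⟨ Σ<-triangle N g ⟩
  Σ< N (λ a → Σ< (N ∸ a) (g a))                                 ≡⟨ Σ<-truncate (suc d) N _ (ℕP.m≤m+n (suc d) (suc e)) highRows ⟩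
  Σ< (suc d) (λ a → Σ< (N ∸ a) (g a))                           ≡⟨ Σ<-cong (suc d) row ⟩
  Σ< (suc d) (λ a → Σ< (suc e) (λ b → p a * x ^ℚ a * (q b * x ^ℚ b)))
    ≡⟨ Σ<-cong′ (suc d) (λ a → sym (*-distribˡ-Σ< (suc e) (p a * x ^ℚ a) (λ b → q b * x ^ℚ b))) ⟩
  Σ< (suc d) (λ a → p a * x ^ℚ a * eval (suc e) q x)           ≡⟨ *-distribʳ-Σ< (suc d) _ _ ⟨
  eval (suc d) p x * eval (suc e) q x                           ∎
  where
  N = suc d ℕ.+ suc e
  degpq : Deg< (suc (d ℕ.+ e)) (p ⊗ q)
  degpq = ⊗-Deg< d e degp degq
  d+e<N : suc (d ℕ.+ e) ℕ.≤ N
  d+e<N = s≤s (ℕP.≤-trans (ℕP.n≤1+n (d ℕ.+ e)) (ℕP.≤-reflexive (sym (ℕP.+-suc d e))))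
  g : ℕ → ℕ → ℚ
  g a b = p a * x ^ℚ a * (q b * x ^ℚ b)
  expand : ∀ i → (p ⊗ q) i * x ^ℚ i ≡ Σ< (suc i) (λ a → g a (i ∸ a))
  expand i = trans (*-distribʳ-Σ< (suc i) (x ^ℚ i) _) (Σ<-cong (suc i) (λ a a≤i → begin
    p a * q (i ∸ a) * x ^ℚ i                        ≡⟨ cong (λ k → p a * q (i ∸ a) * x ^ℚ k) (ℕP.m+[n∸m]≡n (ℕP.≤-pred a≤i)) ⟨
    p a * q (i ∸ a) * x ^ℚ (a ℕ.+ (i ∸ a))          ≡⟨ cong (p a * q (i ∸ a) *_) (^ℚ-distribˡ-+-* x a (i ∸ a)) ⟩
    p a * q (i ∸ a) * (x ^ℚ a * x ^ℚ (i ∸ a))       ≡⟨ regroup (p a) (q (i ∸ a)) (x ^ℚ a) (x ^ℚ (i ∸ a)) ⟩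
    g a (i ∸ a)                                     ∎))
    where
    regroup : ∀ u v s t → u * v * (s * t) ≡ u * s * (v * t)
    regroup = ring-solve-∀ ℚ-ring
  highRows : ∀ a → suc d ℕ.≤ a → Σ< (N ∸ a) (g a) ≡ 0ℚ
  highRows a d<a = Σ<-zero (N ∸ a) (λ b _ → trans (cong (λ c → c * x ^ℚ a * (q b * x ^ℚ b)) (degp a d<a))
    (trans (cong (_* (q b * x ^ℚ b)) (*-zeroˡ (x ^ℚ a))) (*-zeroˡ (q b * x ^ℚ b))))
  row : ∀ a → a ℕ.< suc d → Σ< (N ∸ a) (g a) ≡ Σ< (suc e) (g a)
  row a a≤d = Σ<-truncate (suc e) (N ∸ a) (g a) (m≤n∧n+o<p⇒o<p∸m (ℕP.≤-pred a≤d) d+e<N)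
    (λ b e<b → trans (cong (λ c → p a * x ^ℚ a * (c * x ^ℚ b)) (degq b e<b))
      (trans (cong (p a * x ^ℚ a *_) (*-zeroˡ (x ^ℚ b))) (*-zeroʳ (p a * x ^ℚ a))))

∂-⊗ : ∀ p q i → ∂ (p ⊗ q) i ≡ (∂ p ⊗ q) i + (p ⊗ ∂ q) i
∂-⊗ p q i = begin
  ι (suc i) * Σ< (suc (suc i)) h                                        ≡⟨ *-distribˡ-Σ< (suc (suc i)) (ι (suc i)) h ⟩
  Σ< (suc (suc i)) (λ a → ι (suc i) * h a)                              ≡⟨ Σ<-cong (suc (suc i)) split ⟩
  Σ< (suc (suc i)) (λ a → ι a * h a + ι (suc i ∸ a) * h a)               ≡⟨ Σ<-distrib-+ (suc (suc i)) _ _ ⟩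
  Σ< (suc (suc i)) (λ a → ι a * h a) + Σ< (suc (suc i)) (λ a → ι (suc i ∸ a) * h a)
                                                                       ≡⟨ cong₂ _+_ left right ⟩
  (∂ p ⊗ q) i + (p ⊗ ∂ q) i                                             ∎
  where
  h : ℕ → ℚ
  h a = p a * q (suc i ∸ a)
  split : ∀ a → a ℕ.< suc (suc i) → ι (suc i) * h a ≡ ι a * h a + ι (suc i ∸ a) * h a
  split a a≤1+i = begin
    ι (suc i) * h a                      ≡⟨ cong (λ k → ι k * h a) (ℕP.m+[n∸m]≡n (ℕP.≤-pred a≤1+i)) ⟨
    ι (a ℕ.+ (suc i ∸ a)) * h a          ≡⟨ cong (_* h a) (ι-homo-+ a (suc i ∸ a)) ⟩
    (ι a + ι (suc i ∸ a)) * h a          ≡⟨ *-distribʳ-+ (h a) (ι a) (ι (suc i ∸ a)) ⟩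
    ι a * h a + ι (suc i ∸ a) * h a      ∎
  left : Σ< (suc (suc i)) (λ a → ι a * h a) ≡ (∂ p ⊗ q) i
  left = begin
    Σ< (suc (suc i)) (λ a → ι a * h a)                       ≡⟨ Σ<-head (suc i) _ ⟩
    0ℚ * h 0 + Σ< (suc i) (λ a → ι (suc a) * h (suc a))      ≡⟨ cong (_+ Σ< (suc i) (λ a → ι (suc a) * h (suc a))) (*-zeroˡ (h 0)) ⟩
    0ℚ + Σ< (suc i) (λ a → ι (suc a) * h (suc a))            ≡⟨ +-identityˡ _ ⟩
    Σ< (suc i) (λ a → ι (suc a) * h (suc a))                 ≡⟨ Σ<-cong′ (suc i) (λ a → sym (*-assoc (ι (suc a)) (p (suc a)) _)) ⟩
    (∂ p ⊗ q) i                                              ∎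
  right : Σ< (suc (suc i)) (λ a → ι (suc i ∸ a) * h a) ≡ (p ⊗ ∂ q) i
  right = begin
    Σ< (suc i) (λ a → ι (suc i ∸ a) * h a) + ι (suc i ∸ suc i) * h (suc i)
      ≡⟨ cong (λ k → Σ< (suc i) (λ a → ι (suc i ∸ a) * h a) + ι k * h (suc i)) (ℕP.n∸n≡0 i) ⟩
    Σ< (suc i) (λ a → ι (suc i ∸ a) * h a) + 0ℚ * h (suc i)
      ≡⟨ trans (cong (Σ< (suc i) (λ a → ι (suc i ∸ a) * h a) +_) (*-zeroˡ (h (suc i)))) (+-identityʳ _) ⟩
    Σ< (suc i) (λ a → ι (suc i ∸ a) * h a)
      ≡⟨ Σ<-cong (suc i) (λ a a≤i → trans (cong (λ k → ι k * (p a * q k)) (ℕP.+-∸-assoc 1 (ℕP.≤-pred a≤i)))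
                                     (swap (ι (suc (i ∸ a))) (p a) _)) ⟩
    (p ⊗ ∂ q) i ∎
    where
    swap : ∀ u v w → u * (v * w) ≡ v * (u * w)
    swap = ring-solve-∀ ℚ-ring

∫₀¹-∂ : ∀ N r → r 0 + ∫₀¹ N (∂ r) ≡ Σ< (suc N) r
∫₀¹-∂ N r = trans (cong (r 0 +_) (Σ<-cong′ N cancel)) (sym (Σ<-head N r))
  where
  cancel : ∀ i → ι (suc i) * r (suc i) * frac 1 (suc i) ≡ r (suc i)
  cancel i = begin
    ι (suc i) * r (suc i) * frac 1 (suc i)   ≡⟨ rearrange (ι (suc i)) (r (suc i)) (frac 1 (suc i)) ⟩
    r (suc i) * (frac 1 (suc i) * ι (suc i)) ≡⟨ cong (r (suc i) *_) (frac-*-ι 1 (suc i)) ⟩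
    r (suc i) * 1ℚ                           ≡⟨ *-identityʳ _ ⟩
    r (suc i)                                ∎
    where
    rearrange : ∀ u v w → u * v * w ≡ v * (w * u)
    rearrange = ring-solve-∀ ℚ-ring

-- Bernoulli numbers and polynomials

≤⇒≤ᵇ≡true : ∀ {m n} → m ℕ.≤ n → (m ℕ.≤ᵇ n) ≡ true
≤⇒≤ᵇ≡true m≤n = Equivalence.to T-≡ (ℕP.≤⇒≤ᵇ m≤n)

>⇒≤ᵇ≡false : ∀ {m n} → n ℕ.< m → (m ℕ.≤ᵇ n) ≡ false
>⇒≤ᵇ≡false {m} {n} n<m with m ℕ.≤ᵇ n in eq
... | false = refl
... | true  = ⊥-elim (ℕP.<⇒≱ n<m (ℕP.≤ᵇ⇒≤ m n (Equivalence.from T-≡ eq)))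

bernTab-stable : ∀ m i → i ℕ.≤ m → bernTab m i ≡ B i
bernTab-stable zero    .zero z≤n = refl
bernTab-stable (suc m) i i≤1+m with ℕP.m≤n⇒m<n∨m≡n i≤1+m
... | inj₂ refl = refl
... | inj₁ i≤m  = trans (cong (if_then bernTab m i else _) (≤⇒≤ᵇ≡true (ℕP.≤-pred i≤m))) (bernTab-stable m i (ℕP.≤-pred i≤m))

B-suc : ∀ m → B (suc m) ≡ - (frac 1 (suc (suc m)) * Σ< (suc m) (λ i → ι (suc (suc m) C i) * B i))
B-suc m = trans (cong (if_then bernTab m (suc m) else recurrence) (>⇒≤ᵇ≡false (ℕP.n<1+n m)))
  (cong₂ (λ d S → - (frac 1 d * S)) (ℕP.+-comm m 2)
    (Σ<-cong (suc m) (λ i i≤m → cong₂ (λ c b → ι (c C i) * b) (ℕP.+-comm m 2) (bernTab-stable m i (ℕP.≤-pred i≤m)))))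
  where
  recurrence = - (frac 1 (m ℕ.+ 2) * Σ< (suc m) (λ i → ι ((m ℕ.+ 2) C i) * bernTab m i))

bernoulli-recurrence : ∀ m → Σ< (suc (suc m)) (λ i → ι (suc (suc m) C i) * B i) ≡ 0ℚ
bernoulli-recurrence m = begin
  S + ι (suc (suc m) C suc m) * B (suc m)                     ≡⟨ cong₂ (λ c b → S + ι c * b) C-last (B-suc m) ⟩
  S + ι (suc (suc m)) * (- (frac 1 (suc (suc m)) * S))        ≡⟨ rearrange S (ι (suc (suc m))) (frac 1 (suc (suc m))) ⟩
  S - frac 1 (suc (suc m)) * ι (suc (suc m)) * S             ≡⟨ cong (λ c → S - c * S) (frac-*-ι 1 (suc (suc m))) ⟩
  S - 1ℚ * S                                                 ≡⟨ cancel S ⟩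
  0ℚ                                                         ∎
  where
  S = Σ< (suc m) (λ i → ι (suc (suc m) C i) * B i)
  C-last : suc (suc m) C suc m ≡ suc (suc m)
  C-last = begin
    suc (suc m) C suc m                     ≡⟨ nCk≡nC[n∸k] (ℕP.n≤1+n (suc m)) ⟩
    suc (suc m) C (suc (suc m) ∸ suc m)      ≡⟨ cong (suc (suc m) C_) (ℕP.m+n∸n≡m 1 (suc m)) ⟩
    suc (suc m) C 1                         ≡⟨ nC1≡n (suc (suc m)) ⟩
    suc (suc m)                             ∎
  rearrange : ∀ s a b → s + a * (- (b * s)) ≡ s - b * a * s
  rearrange = ring-solve-∀ ℚ-ring
  cancel : ∀ s → s - 1ℚ * s ≡ 0ℚ
  cancel = ring-solve-∀ ℚ-ring

nCk*[k!*[n∸k]!]≡n! : ∀ n k → k ℕ.≤ n → (n C k) ℕ.* (k ! ℕ.* (n ∸ k) !) ≡ n !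
nCk*[k!*[n∸k]!]≡n! n k k≤n =
  trans (cong (ℕ._* (k ! ℕ.* (n ∸ k) !)) (nCk≡n!/k![n-k]! k≤n)) (m/n*n≡m (k![n∸k]!∣n! k≤n))
  where instance _ = ℕP._!*_!≢0 k (n ∸ k)

[1+i]*[1+k]C[1+i]≡[1+k]*kCi : ∀ k i → suc i ℕ.* (suc k C suc i) ≡ suc k ℕ.* (k C i)
[1+i]*[1+k]C[1+i]≡[1+k]*kCi k i with i ℕ.≤? k
... | no i≰k = begin
  suc i ℕ.* (suc k C suc i)  ≡⟨ cong (suc i ℕ.*_) (k>n⇒nCk≡0 (s≤s (ℕP.≰⇒> i≰k))) ⟩
  suc i ℕ.* 0                ≡⟨ ℕP.*-zeroʳ (suc i) ⟩
  0                          ≡⟨ ℕP.*-zeroʳ (suc k) ⟨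
  suc k ℕ.* 0                ≡⟨ cong (suc k ℕ.*_) (k>n⇒nCk≡0 (ℕP.≰⇒> i≰k)) ⟨
  suc k ℕ.* (k C i)          ∎
... | yes i≤k = ℕP.*-cancelʳ-≡ _ _ (i ! ℕ.* (k ∸ i) !) {{ℕP._!*_!≢0 i (k ∸ i)}} (begin
  suc i ℕ.* (suc k C suc i) ℕ.* (i ! ℕ.* (k ∸ i) !)  ≡⟨ regroup (suc i) (suc k C suc i) (i !) ((k ∸ i) !) ⟩
  (suc k C suc i) ℕ.* (suc i ! ℕ.* (k ∸ i) !)        ≡⟨ nCk*[k!*[n∸k]!]≡n! (suc k) (suc i) (s≤s i≤k) ⟩
  suc k !                                           ≡⟨ cong (suc k ℕ.*_) (nCk*[k!*[n∸k]!]≡n! k i i≤k) ⟨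
  suc k ℕ.* ((k C i) ℕ.* (i ! ℕ.* (k ∸ i) !))        ≡⟨ ℕP.*-assoc (suc k) (k C i) _ ⟨
  suc k ℕ.* (k C i) ℕ.* (i ! ℕ.* (k ∸ i) !)          ∎)
  where
  regroup : ∀ a b c d → a ℕ.* b ℕ.* (c ℕ.* d) ≡ b ℕ.* (a ℕ.* c ℕ.* d)
  regroup = solve-∀

Σ<-binomial-reverse : ∀ n (f g : ℕ → ℚ) →
  Σ< (suc n) (λ i → ι (n C i) * f (n ∸ i) * g i) ≡ Σ< (suc n) (λ i → ι (n C i) * f i * g (n ∸ i))
Σ<-binomial-reverse n f g = trans (Σ<-reverse n _) (Σ<-cong (suc n) (λ i i≤n →
  cong₂ (λ c j → ι c * f j * g (n ∸ i)) (sym (nCk≡nC[n∸k] (ℕP.≤-pred i≤n))) (ℕP.m∸[m∸n]≡n (ℕP.≤-pred i≤n))))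

bern : ℕ → Poly
bern k i = ι (k C i) * B (k ∸ i)

bern-Deg< : ∀ k → Deg< (suc k) (bern k)
bern-Deg< k i k<i = trans (cong (λ c → ι c * B (k ∸ i)) (k>n⇒nCk≡0 k<i)) (*-zeroˡ (B (k ∸ i)))

bern-at-0 : ∀ k → bern k 0 ≡ B k
bern-at-0 k = *-identityˡ (B k)

bern-0 : ∀ i → bern 0 i ≡ 𝟙 i
bern-0 zero    = refl
bern-0 (suc i) = bern-Deg< 0 (suc i) (s≤s z≤n)

Bpoly≡eval-bern : ∀ n x → Bpoly n x ≡ eval (suc n) (bern n) x
Bpoly≡eval-bern n x = sym (Σ<-binomial-reverse n B (x ^ℚ_))

-- The Appell property; at k = 0 both sides vanish, so the truncated k ∸ 1 is harmless.
∂-bern : ∀ k i → ∂ (bern k) i ≡ ι k * bern (k ∸ 1) i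
∂-bern zero    i = begin
  ι (suc i) * bern 0 (suc i)  ≡⟨ cong (ι (suc i) *_) (bern-0 (suc i)) ⟩
  ι (suc i) * 0ℚ              ≡⟨ *-zeroʳ (ι (suc i)) ⟩
  0ℚ                          ≡⟨ *-zeroˡ (bern 0 i) ⟨
  ι 0 * bern 0 i              ∎
∂-bern (suc k) i = begin
  ι (suc i) * (ι (suc k C suc i) * B (k ∸ i))    ≡⟨ *-assoc (ι (suc i)) _ _ ⟨
  ι (suc i) * ι (suc k C suc i) * B (k ∸ i)      ≡⟨ cong (_* B (k ∸ i)) (ι-homo-* (suc i) (suc k C suc i)) ⟨
  ι (suc i ℕ.* (suc k C suc i)) * B (k ∸ i)      ≡⟨ cong (λ c → ι c * B (k ∸ i)) ([1+i]*[1+k]C[1+i]≡[1+k]*kCi k i) ⟩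
  ι (suc k ℕ.* (k C i)) * B (k ∸ i)              ≡⟨ cong (_* B (k ∸ i)) (ι-homo-* (suc k) (k C i)) ⟩
  ι (suc k) * ι (k C i) * B (k ∸ i)              ≡⟨ *-assoc (ι (suc k)) _ _ ⟩
  ι (suc k) * bern k i                           ∎

Bpoly-1 : ∀ {k} → 2 ℕ.≤ k → Bpoly k 1ℚ ≡ B k
Bpoly-1 {suc (suc m)} (s≤s (s≤s z≤n)) = begin
  Bpoly n 1ℚ                                                          ≡⟨ Σ<-cong′ (suc n) (λ i → cong (ι (n C i) * B i *_) (1^ℚn≡1 (n ∸ i))) ⟩
  Σ< (suc n) (λ i → ι (n C i) * B i * 1ℚ)                            ≡⟨ Σ<-cong′ (suc n) (λ i → *-identityʳ _) ⟩
  Σ< (suc n) (λ i → ι (n C i) * B i)                                 ≡⟨ cong (_+ ι (n C n) * B n) (bernoulli-recurrence m) ⟩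
  0ℚ + ι (n C n) * B n                                                ≡⟨ cong (λ c → 0ℚ + ι c * B n) (nCn≡1 n) ⟩
  0ℚ + 1ℚ * B n                                                       ≡⟨ trans (+-identityˡ _) (*-identityˡ _) ⟩
  B n                                                                 ∎
  where n = suc (suc m)

∫₀¹-bern-0 : ∀ N → ∫₀¹ (suc N) (bern 0) ≡ 1ℚ
∫₀¹-bern-0 N = begin
  ∫₀¹ (suc N) (bern 0)                                    ≡⟨ Σ<-head N _ ⟩
  1ℚ * 1ℚ + Σ< N (λ i → bern 0 (suc i) * frac 1 (suc (suc i)))
    ≡⟨ cong (1ℚ * 1ℚ +_) (Σ<-zero N (λ i _ → trans (cong (_* frac 1 (suc (suc i))) (bern-0 (suc i))) (*-zeroˡ (frac 1 (suc (suc i)))))) ⟩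
  1ℚ * 1ℚ + 0ℚ                                             ≡⟨ refl ⟩
  1ℚ                                                      ∎

-- ∫₀¹ Bₖ₊₁ = (Bₖ₊₂(1) − Bₖ₊₂(0)) / (k+2) = 0.
∫₀¹-bern-suc : ∀ k N → suc (suc k) ℕ.≤ N → ∫₀¹ N (bern (suc k)) ≡ 0ℚ
∫₀¹-bern-suc k N k+2≤N = *ι-cancelʳ (suc (suc k)) (begin
  ∫₀¹ N (bern (suc k)) * ι (suc (suc k))                 ≡⟨ *-comm _ (ι (suc (suc k))) ⟩
  ι (suc (suc k)) * ∫₀¹ N (bern (suc k))                 ≡⟨ pairing-scale N (ι (suc (suc k))) (bern (suc k)) _ ⟨
  ∫₀¹ N (λ i → ι (suc (suc k)) * bern (suc k) i)         ≡⟨ pairing-cong N _ (λ i → sym (∂-bern (suc (suc k)) i)) ⟩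
  ∫₀¹ N (∂ (bern (suc (suc k))))                         ≡⟨ +-cancelˡ ftc ⟩
  0ℚ                                                    ≡⟨ *-zeroˡ (ι (suc (suc k))) ⟨
  0ℚ * ι (suc (suc k))                                  ∎)
  where
  b = bern (suc (suc k))
  +-cancelˡ : ∀ {a s} → a + s ≡ a → s ≡ 0ℚ
  +-cancelˡ {a} {s} eq = +-cancelʳ a s 0ℚ (trans (+-comm s a) (trans eq (sym (+-identityˡ a))))
  ftc : b 0 + ∫₀¹ N (∂ b) ≡ b 0
  ftc = begin
    b 0 + ∫₀¹ N (∂ b)                     ≡⟨ ∫₀¹-∂ N b ⟩
    Σ< (suc N) b                          ≡⟨ eval-1 (suc N) b ⟨
    eval (suc N) b 1ℚ                     ≡⟨ pairing-truncate (suc (suc (suc k))) (suc N) b _ (s≤s k+2≤N) (bern-Deg< (suc (suc k))) ⟩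
    eval (suc (suc (suc k))) b 1ℚ         ≡⟨ Bpoly≡eval-bern (suc (suc k)) 1ℚ ⟨
    Bpoly (suc (suc k)) 1ℚ                ≡⟨ Bpoly-1 {suc (suc k)} (s≤s (s≤s z≤n)) ⟩
    B (suc (suc k))                       ≡⟨ bern-at-0 (suc (suc k)) ⟨
    b 0                                   ∎

-- The convolution identity for Bernoulli polynomials

ΣBB : ℕ → Poly
ΣBB n i = Σ< (suc n) (λ k → (bern k ⊗ bern (n ∸ k)) i)

ΣBB′ : ℕ → Poly
ΣBB′ n i = frac 2 (suc (suc n)) * Σ< (n ∸ 1) (λ l → B (n ∸ l) * ι (suc (suc n) C l) * bern l i)
         + ι (suc n) * bern n i

∂-ΣBB : ∀ n i → ∂ (ΣBB (suc n)) i ≡ ι (suc (suc n)) * ΣBB n i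
∂-ΣBB n i = begin
  ι (suc i) * Σ< (suc (suc n)) (λ k → (bern k ⊗ bern (suc n ∸ k)) (suc i))
    ≡⟨ *-distribˡ-Σ< (suc (suc n)) (ι (suc i)) _ ⟩
  Σ< (suc (suc n)) (λ k → ∂ (bern k ⊗ bern (suc n ∸ k)) i)
    ≡⟨ trans (Σ<-cong′ (suc (suc n)) leibniz) (Σ<-distrib-+ (suc (suc n)) _ _) ⟩
  Σ< (suc (suc n)) L + Σ< (suc (suc n)) R
    ≡⟨ cong₂ _+_ L-shift R-drop ⟩
  Σ< (suc n) (λ k → ι (suc k) * X k) + Σ< (suc n) (λ k → ι (suc (n ∸ k)) * X k)
    ≡⟨ Σ<-distrib-+ (suc n) _ _ ⟨
  Σ< (suc n) (λ k → ι (suc k) * X k + ι (suc (n ∸ k)) * X k)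
    ≡⟨ Σ<-cong (suc n) combine ⟩
  Σ< (suc n) (λ k → ι (suc (suc n)) * X k)
    ≡⟨ *-distribˡ-Σ< (suc n) (ι (suc (suc n))) X ⟨
  ι (suc (suc n)) * ΣBB n i ∎
  where
  X L R : ℕ → ℚ
  X k = (bern k ⊗ bern (n ∸ k)) i
  L k = ι k * (bern (k ∸ 1) ⊗ bern (suc n ∸ k)) i
  R k = ι (suc n ∸ k) * (bern k ⊗ bern (suc n ∸ k ∸ 1)) i
  leibniz : ∀ k → ∂ (bern k ⊗ bern (suc n ∸ k)) i ≡ L k + R k
  leibniz k = trans (∂-⊗ (bern k) (bern (suc n ∸ k)) i)
    (cong₂ _+_ (⊗-scaleˡ (ι k) (bern (suc n ∸ k)) (∂-bern k) i)
               (⊗-scaleʳ (ι (suc n ∸ k)) (bern k) (∂-bern (suc n ∸ k)) i))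
  L-shift : Σ< (suc (suc n)) L ≡ Σ< (suc n) (λ k → ι (suc k) * X k)
  L-shift = trans (Σ<-head (suc n) L) (trans (cong (_+ Σ< (suc n) (λ k → L (suc k))) (*-zeroˡ ((bern 0 ⊗ bern (suc n)) i))) (+-identityˡ _))
  R-drop : Σ< (suc (suc n)) R ≡ Σ< (suc n) (λ k → ι (suc (n ∸ k)) * X k)
  R-drop = begin
    Σ< (suc n) R + R (suc n)   ≡⟨ cong (λ j → Σ< (suc n) R + ι j * (bern (suc n) ⊗ bern (j ∸ 1)) i) (ℕP.n∸n≡0 n) ⟩
    Σ< (suc n) R + 0ℚ * Y      ≡⟨ trans (cong (Σ< (suc n) R +_) (*-zeroˡ Y)) (+-identityʳ _) ⟩
    Σ< (suc n) R               ≡⟨ Σ<-cong (suc n) (λ k k≤n → cong (λ j → ι j * (bern k ⊗ bern (j ∸ 1)) i) (ℕP.+-∸-assoc 1 (ℕP.≤-pred k≤n))) ⟩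
    Σ< (suc n) (λ k → ι (suc (n ∸ k)) * X k) ∎
    where
    Y = (bern (suc n) ⊗ bern (0 ∸ 1)) i
  combine : ∀ k → k ℕ.< suc n → ι (suc k) * X k + ι (suc (n ∸ k)) * X k ≡ ι (suc (suc n)) * X k
  combine k k≤n = begin
    ι (suc k) * X k + ι (suc (n ∸ k)) * X k   ≡⟨ *-distribʳ-+ (X k) (ι (suc k)) _ ⟨
    (ι (suc k) + ι (suc (n ∸ k))) * X k       ≡⟨ cong (_* X k) (ι-homo-+ (suc k) (suc (n ∸ k))) ⟨
    ι (suc k ℕ.+ suc (n ∸ k)) * X k           ≡⟨ cong (λ j → ι j * X k) (trans (ℕP.+-suc (suc k) _) (cong (λ j → suc (suc j)) (ℕP.m+[n∸m]≡n (ℕP.≤-pred k≤n)))) ⟩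
    ι (suc (suc n)) * X k                     ∎

frac2-binomial-shift : ∀ N l →
  frac 2 (suc (suc N)) * ι (suc (suc N) C suc l) * ι (suc l) ≡ ι (suc N) * frac 2 (suc N) * ι (suc N C l)
frac2-binomial-shift N l = begin
  frac 2 (suc (suc N)) * ι (suc (suc N) C suc l) * ι (suc l)   ≡⟨ solve₁ (frac 2 (suc (suc N))) (ι (suc (suc N) C suc l)) (ι (suc l)) ⟩
  frac 2 (suc (suc N)) * (ι (suc l) * ι (suc (suc N) C suc l)) ≡⟨ cong (frac 2 (suc (suc N)) *_) absorb ⟩
  frac 2 (suc (suc N)) * (ι (suc (suc N)) * ι (suc N C l))     ≡⟨ *-assoc (frac 2 (suc (suc N))) (ι (suc (suc N))) (ι (suc N C l)) ⟨
  frac 2 (suc (suc N)) * ι (suc (suc N)) * ι (suc N C l)       ≡⟨ cong (_* ι (suc N C l)) (trans (frac-*-ι 2 (suc (suc N))) (sym (frac-*-ι 2 (suc N)))) ⟩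
  frac 2 (suc N) * ι (suc N) * ι (suc N C l)                   ≡⟨ cong (_* ι (suc N C l)) (*-comm (frac 2 (suc N)) (ι (suc N))) ⟩
  ι (suc N) * frac 2 (suc N) * ι (suc N C l)                   ∎
  where
  solve₁ : ∀ f c l → f * c * l ≡ f * (l * c)
  solve₁ = ring-solve-∀ ℚ-ring
  absorb : ι (suc l) * ι (suc (suc N) C suc l) ≡ ι (suc (suc N)) * ι (suc N C l)
  absorb = trans (sym (ι-homo-* (suc l) (suc (suc N) C suc l)))
    (trans (cong ι ([1+i]*[1+k]C[1+i]≡[1+k]*kCi (suc N) l)) (ι-homo-* (suc (suc N)) (suc N C l)))

∂-ΣBB′-sum : ∀ n i →
  frac 2 (suc (suc (suc n))) * Σ< n (λ l → B (suc n ∸ l) * ι (suc (suc (suc n)) C l) * ∂ (bern l) i)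
    ≡ ι (suc (suc n)) * (frac 2 (suc (suc n)) * Σ< (n ∸ 1) (λ l → B (n ∸ l) * ι (suc (suc n) C l) * bern l i))
∂-ΣBB′-sum zero    i = trans (*-zeroʳ (frac 2 3)) (sym (trans (cong (ι 2 *_) (*-zeroʳ (frac 2 2))) (*-zeroʳ (ι 2))))
∂-ΣBB′-sum (suc m) i = begin
  α * Σ< (suc m) (λ l → b l * ι (N C l) * ∂ (bern l) i)
    ≡⟨ cong (α *_) (Σ<-head m _) ⟩
  α * (b 0 * ι (N C 0) * ∂ (bern 0) i + Σ< m (λ l → b (suc l) * ι (N C suc l) * ∂ (bern (suc l)) i))
    ≡⟨ cong (λ t → α * (t + Σ< m (λ l → b (suc l) * ι (N C suc l) * ∂ (bern (suc l)) i)))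
            (trans (cong (b 0 * ι (N C 0) *_) (trans (∂-bern 0 i) (*-zeroˡ (bern 0 i)))) (*-zeroʳ (b 0 * ι (N C 0)))) ⟩
  α * (0ℚ + Σ< m (λ l → b (suc l) * ι (N C suc l) * ∂ (bern (suc l)) i))
    ≡⟨ trans (cong (α *_) (+-identityˡ _)) (*-distribˡ-Σ< m α _) ⟩
  Σ< m (λ l → α * (b (suc l) * ι (N C suc l) * ∂ (bern (suc l)) i))
    ≡⟨ Σ<-cong′ m term ⟩
  Σ< m (λ l → ι M * frac 2 M * T l)
    ≡⟨ *-distribˡ-Σ< m (ι M * frac 2 M) T ⟨
  ι M * frac 2 M * Σ< m T
    ≡⟨ *-assoc (ι M) (frac 2 M) (Σ< m T) ⟩
  ι M * (frac 2 M * Σ< m T) ∎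
  where
  M = suc (suc (suc m))
  N = suc M
  α = frac 2 N
  b T : ℕ → ℚ
  b l = B (suc (suc m) ∸ l)
  T l = b (suc l) * ι (M C l) * bern l i
  term : ∀ l → α * (b (suc l) * ι (N C suc l) * ∂ (bern (suc l)) i) ≡ ι M * frac 2 M * T l
  term l = begin
    α * (b (suc l) * ι (N C suc l) * ∂ (bern (suc l)) i)       ≡⟨ cong (λ t → α * (b (suc l) * ι (N C suc l) * t)) (∂-bern (suc l) i) ⟩
    α * (b (suc l) * ι (N C suc l) * (ι (suc l) * bern l i))   ≡⟨ regroup α (b (suc l)) (ι (N C suc l)) (ι (suc l)) (bern l i) ⟩
    α * ι (N C suc l) * ι (suc l) * (b (suc l) * bern l i)     ≡⟨ cong (_* (b (suc l) * bern l i)) (frac2-binomial-shift (suc (suc m)) l) ⟩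
    ι M * frac 2 M * ι (M C l) * (b (suc l) * bern l i)        ≡⟨ regroup′ (ι M * frac 2 M) (ι (M C l)) (b (suc l)) (bern l i) ⟩
    ι M * frac 2 M * T l                                       ∎
    where
    regroup : ∀ f b c d p → f * (b * c * (d * p)) ≡ f * c * d * (b * p)
    regroup = ring-solve-∀ ℚ-ring
    regroup′ : ∀ g c b p → g * c * (b * p) ≡ g * (b * c * p)
    regroup′ = ring-solve-∀ ℚ-ring

∂-ΣBB′ : ∀ n i → ∂ (ΣBB′ (suc n)) i ≡ ι (suc (suc n)) * ΣBB′ n i
∂-ΣBB′ n i = begin
  ι (suc i) * (α * Σ< n (λ l → c l * bern l (suc i)) + β * bern (suc n) (suc i))
    ≡⟨ distribute (ι (suc i)) α (Σ< n (λ l → c l * bern l (suc i))) β (bern (suc n) (suc i)) ⟩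
  α * (ι (suc i) * Σ< n (λ l → c l * bern l (suc i))) + β * ∂ (bern (suc n)) i
    ≡⟨ cong₂ (λ s t → α * s + β * t)
             (trans (*-distribˡ-Σ< n (ι (suc i)) (λ l → c l * bern l (suc i))) (Σ<-cong′ n (λ l → pull (ι (suc i)) (c l) (bern l (suc i)))))
             (∂-bern (suc n) i) ⟩
  α * Σ< n (λ l → c l * ∂ (bern l) i) + β * (ι (suc n) * bern n i)
    ≡⟨ cong (_+ β * (ι (suc n) * bern n i)) (∂-ΣBB′-sum n i) ⟩
  β * (frac 2 (suc (suc n)) * Σ< (n ∸ 1) (λ l → B (n ∸ l) * ι (suc (suc n) C l) * bern l i)) + β * (ι (suc n) * bern n i)
    ≡⟨ *-distribˡ-+ β _ _ ⟨
  β * ΣBB′ n i ∎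
  where
  α = frac 2 (suc (suc (suc n)))
  β = ι (suc (suc n))
  c : ℕ → ℚ
  c l = B (suc n ∸ l) * ι (suc (suc (suc n)) C l)
  distribute : ∀ a f s g b → a * (f * s + g * b) ≡ f * (a * s) + g * (a * b)
  distribute = ring-solve-∀ ℚ-ring
  pull : ∀ a c b → a * (c * b) ≡ c * (a * b)
  pull = ring-solve-∀ ℚ-ring

∫₀¹-bern-by-parts : ∀ k l N → suc k ℕ.+ suc l ℕ.≤ N →
  ι (suc k) * ∫₀¹ N (bern k ⊗ bern (suc l)) + ι (suc l) * ∫₀¹ N (bern (suc k) ⊗ bern l)
    ≡ Bpoly (suc k) 1ℚ * Bpoly (suc l) 1ℚ - B (suc k) * B (suc l)
∫₀¹-bern-by-parts k l N k+l+2≤N = begin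
  ι (suc k) * ∫₀¹ N (bern k ⊗ bern (suc l)) + ι (suc l) * ∫₀¹ N (bern (suc k) ⊗ bern l)
    ≡⟨ pairing-linear N (ι (suc k)) (ι (suc l)) (bern k ⊗ bern (suc l)) (bern (suc k) ⊗ bern l) _ ⟨
  ∫₀¹ N (λ i → ι (suc k) * (bern k ⊗ bern (suc l)) i + ι (suc l) * (bern (suc k) ⊗ bern l) i)
    ≡⟨ pairing-cong N _ leibniz ⟨
  ∫₀¹ N (∂ r)
    ≡⟨ trans (s≡a+s-a (r 0) (∫₀¹ N (∂ r))) (cong (_- r 0) (∫₀¹-∂ N r)) ⟩
  Σ< (suc N) r - r 0
    ≡⟨ cong₂ _-_ values (trans (⊗-at-0 (bern (suc k)) (bern (suc l))) (cong₂ _*_ (bern-at-0 (suc k)) (bern-at-0 (suc l)))) ⟩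
  Bpoly (suc k) 1ℚ * Bpoly (suc l) 1ℚ - B (suc k) * B (suc l) ∎
  where
  r = bern (suc k) ⊗ bern (suc l)
  leibniz : ∀ i → ∂ r i ≡ ι (suc k) * (bern k ⊗ bern (suc l)) i + ι (suc l) * (bern (suc k) ⊗ bern l) i
  leibniz i = trans (∂-⊗ (bern (suc k)) (bern (suc l)) i)
    (cong₂ _+_ (⊗-scaleˡ (ι (suc k)) (bern (suc l)) (∂-bern (suc k)) i)
               (⊗-scaleʳ (ι (suc l)) (bern (suc k)) (∂-bern (suc l)) i))
  s≡a+s-a : ∀ a s → s ≡ a + s - a
  s≡a+s-a = ring-solve-∀ ℚ-ring
  values : Σ< (suc N) r ≡ Bpoly (suc k) 1ℚ * Bpoly (suc l) 1ℚ
  values = begin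
    Σ< (suc N) r                                                      ≡⟨ eval-1 (suc N) r ⟨
    eval (suc N) r 1ℚ                                                 ≡⟨ eval-⊗ (suc k) (suc l) N 1ℚ (bern-Deg< (suc k)) (bern-Deg< (suc l)) k+l+2≤N ⟩
    eval (suc (suc k)) (bern (suc k)) 1ℚ * eval (suc (suc l)) (bern (suc l)) 1ℚ
                                                                      ≡⟨ cong₂ _*_ (Bpoly≡eval-bern (suc k) 1ℚ) (Bpoly≡eval-bern (suc l) 1ℚ) ⟨
    Bpoly (suc k) 1ℚ * Bpoly (suc l) 1ℚ                               ∎

Σ<-shift-weights : ∀ n (a : ℕ → ℚ) → a 0 ≡ 0ℚ → a n ≡ 0ℚ →
  Σ< n (λ k → ι (suc k) * a k + ι (n ∸ k) * a (suc k)) ≡ ι (suc (suc n)) * Σ< (suc n) a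
Σ<-shift-weights n a a₀≡0 aₙ≡0 = begin
  Σ< n (λ k → ι (suc k) * a k + ι (n ∸ k) * a (suc k))
    ≡⟨ Σ<-distrib-+ n _ _ ⟩
  Σ< n (λ k → ι (suc k) * a k) + Σ< n (λ k → ι (n ∸ k) * a (suc k))
    ≡⟨ cong₂ _+_ appendLast prependFirst ⟩
  Σ< (suc n) (λ j → ι (suc j) * a j) + Σ< (suc n) (λ j → ι (suc n ∸ j) * a j)
    ≡⟨ Σ<-distrib-+ (suc n) _ _ ⟨
  Σ< (suc n) (λ j → ι (suc j) * a j + ι (suc n ∸ j) * a j)
    ≡⟨ Σ<-cong (suc n) combine ⟩
  Σ< (suc n) (λ j → ι (suc (suc n)) * a j)
    ≡⟨ *-distribˡ-Σ< (suc n) (ι (suc (suc n))) a ⟨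
  ι (suc (suc n)) * Σ< (suc n) a ∎
  where
  appendLast : Σ< n (λ k → ι (suc k) * a k) ≡ Σ< (suc n) (λ j → ι (suc j) * a j)
  appendLast = sym (trans (cong (λ t → Σ< n (λ k → ι (suc k) * a k) + ι (suc n) * t) aₙ≡0)
    (trans (cong (Σ< n (λ k → ι (suc k) * a k) +_) (*-zeroʳ (ι (suc n)))) (+-identityʳ _)))
  prependFirst : Σ< n (λ k → ι (n ∸ k) * a (suc k)) ≡ Σ< (suc n) (λ j → ι (suc n ∸ j) * a j)
  prependFirst = sym (trans (Σ<-head n (λ j → ι (suc n ∸ j) * a j))
    (trans (cong (λ t → ι (suc n) * t + Σ< n (λ k → ι (n ∸ k) * a (suc k))) a₀≡0)
    (trans (cong (_+ Σ< n (λ k → ι (n ∸ k) * a (suc k))) (*-zeroʳ (ι (suc n)))) (+-identityˡ _))))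
  combine : ∀ j → j ℕ.< suc n → ι (suc j) * a j + ι (suc n ∸ j) * a j ≡ ι (suc (suc n)) * a j
  combine j j≤n = begin
    ι (suc j) * a j + ι (suc n ∸ j) * a j      ≡⟨ *-distribʳ-+ (a j) (ι (suc j)) (ι (suc n ∸ j)) ⟨
    (ι (suc j) + ι (suc n ∸ j)) * a j          ≡⟨ cong (_* a j) (ι-homo-+ (suc j) (suc n ∸ j)) ⟨
    ι (suc j ℕ.+ (suc n ∸ j)) * a j            ≡⟨ cong (λ t → ι (suc t) * a j) (ℕP.m+[n∸m]≡n (ℕP.m≤n⇒m≤1+n (ℕP.≤-pred j≤n))) ⟩
    ι (suc (suc n)) * a j                      ∎

Σ<-Bpoly-boundary : ∀ m →
  Σ< (suc (suc m)) (λ k → Bpoly (suc k) 1ℚ * Bpoly (suc (suc m ∸ k)) 1ℚ - B (suc k) * B (suc (suc m ∸ k)))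
    ≡ ι 2 * B (suc (suc m))
Σ<-Bpoly-boundary m = begin
  Σ< (suc (suc m)) f                                 ≡⟨ Σ<-head (suc m) f ⟩
  f 0 + (Σ< m (λ j → f (suc j)) + f (suc m))         ≡⟨ cong₂ (λ s t → f 0 + (s + t)) (Σ<-zero m middle) last ⟩
  f 0 + (0ℚ + (Bₙ * (1ℚ + B 1) - Bₙ * B 1))          ≡⟨ cong (λ t → t + (0ℚ + (Bₙ * (1ℚ + B 1) - Bₙ * B 1))) first ⟩
  (1ℚ + B 1) * Bₙ - B 1 * Bₙ + (0ℚ + (Bₙ * (1ℚ + B 1) - Bₙ * B 1)) ≡⟨ collect (B 1) Bₙ ⟩
  ι 2 * Bₙ                                           ∎
  where
  Bₙ = B (suc (suc m))
  f : ℕ → ℚ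
  f k = Bpoly (suc k) 1ℚ * Bpoly (suc (suc m ∸ k)) 1ℚ - B (suc k) * B (suc (suc m ∸ k))
  first : f 0 ≡ (1ℚ + B 1) * Bₙ - B 1 * Bₙ
  first = cong (λ t → (1ℚ + B 1) * t - B 1 * Bₙ) (Bpoly-1 {suc (suc m)} (s≤s (s≤s z≤n)))
  last : f (suc m) ≡ Bₙ * (1ℚ + B 1) - Bₙ * B 1
  last = begin
    Bpoly Bₙ′ 1ℚ * Bpoly (suc (m ∸ m)) 1ℚ - Bₙ * B (suc (m ∸ m))
      ≡⟨ cong (λ j → Bpoly Bₙ′ 1ℚ * Bpoly (suc j) 1ℚ - Bₙ * B (suc j)) (ℕP.n∸n≡0 m) ⟩
    Bpoly Bₙ′ 1ℚ * (1ℚ + B 1) - Bₙ * B 1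
      ≡⟨ cong (λ t → t * (1ℚ + B 1) - Bₙ * B 1) (Bpoly-1 {Bₙ′} (s≤s (s≤s z≤n))) ⟩
    Bₙ * (1ℚ + B 1) - Bₙ * B 1 ∎
    where Bₙ′ = suc (suc m)
  middle : ∀ j → j ℕ.< m → f (suc j) ≡ 0ℚ
  middle j j<m = begin
    Bpoly (suc (suc j)) 1ℚ * Bpoly (suc (m ∸ j)) 1ℚ - B (suc (suc j)) * B (suc (m ∸ j))
      ≡⟨ cong₂ (λ s t → s * t - B (suc (suc j)) * B (suc (m ∸ j)))
               (Bpoly-1 {suc (suc j)} (s≤s (s≤s z≤n))) (Bpoly-1 {suc (m ∸ j)} (s≤s (ℕP.m<n⇒0<n∸m j<m))) ⟩
    B (suc (suc j)) * B (suc (m ∸ j)) - B (suc (suc j)) * B (suc (m ∸ j))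
      ≡⟨ +-inverseʳ (B (suc (suc j)) * B (suc (m ∸ j))) ⟩
    0ℚ ∎
  collect : ∀ b c → (1ℚ + b) * c - b * c + (0ℚ + (c * (1ℚ + b) - c * b)) ≡ ι 2 * c
  collect = ring-solve-∀ ℚ-ring

∫₀¹-ΣBB : ∀ m → ∫₀¹ (suc (suc (suc m))) (ΣBB (suc (suc m))) ≡ frac 2 (suc (suc (suc (suc m)))) * B (suc (suc m))
∫₀¹-ΣBB m = *ι-cancelʳ (suc (suc n)) (begin
  ∫₀¹ N (ΣBB n) * ι (suc (suc n))                         ≡⟨ *-comm (∫₀¹ N (ΣBB n)) (ι (suc (suc n))) ⟩
  ι (suc (suc n)) * ∫₀¹ N (ΣBB n)                         ≡⟨ cong (ι (suc (suc n)) *_) (pairing-Σ< N (suc n) (λ k → bern k ⊗ bern (n ∸ k)) _) ⟩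
  ι (suc (suc n)) * Σ< (suc n) a                          ≡⟨ Σ<-shift-weights n a a₀≡0 aₙ≡0 ⟨
  Σ< n (λ k → ι (suc k) * a k + ι (n ∸ k) * a (suc k))    ≡⟨ Σ<-cong n by-parts ⟩
  Σ< n (λ k → Bpoly (suc k) 1ℚ * Bpoly (suc (suc m ∸ k)) 1ℚ - B (suc k) * B (suc (suc m ∸ k)))
                                                          ≡⟨ Σ<-Bpoly-boundary m ⟩
  ι 2 * B n                                               ≡⟨ cong (_* B n) (frac-*-ι 2 (suc (suc n))) ⟨
  frac 2 (suc (suc n)) * ι (suc (suc n)) * B n            ≡⟨ swap (frac 2 (suc (suc n))) (ι (suc (suc n))) (B n) ⟩
  frac 2 (suc (suc n)) * B n * ι (suc (suc n))            ∎)
  where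
  n = suc (suc m)
  N = suc n
  a : ℕ → ℚ
  a k = ∫₀¹ N (bern k ⊗ bern (n ∸ k))
  a₀≡0 : a 0 ≡ 0ℚ
  a₀≡0 = trans (pairing-cong N _ (⊗-identityˡ (bern n) bern-0)) (∫₀¹-bern-suc (suc m) N ℕP.≤-refl)
  aₙ≡0 : a n ≡ 0ℚ
  aₙ≡0 = trans (cong (λ j → ∫₀¹ N (bern n ⊗ bern j)) (ℕP.n∸n≡0 n))
    (trans (pairing-cong N _ (⊗-identityʳ (bern n) bern-0)) (∫₀¹-bern-suc (suc m) N ℕP.≤-refl))
  by-parts : ∀ k → k ℕ.< n → ι (suc k) * a k + ι (n ∸ k) * a (suc k)
    ≡ Bpoly (suc k) 1ℚ * Bpoly (suc (suc m ∸ k)) 1ℚ - B (suc k) * B (suc (suc m ∸ k))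
  by-parts k k≤1+m = trans
    (cong (λ j → ι (suc k) * ∫₀¹ N (bern k ⊗ bern j) + ι j * a (suc k)) (ℕP.+-∸-assoc 1 (ℕP.≤-pred k≤1+m)))
    (∫₀¹-bern-by-parts k (suc m ∸ k) N (ℕP.≤-reflexive fits))
    where
    fits : suc k ℕ.+ suc (suc m ∸ k) ≡ N
    fits = trans (ℕP.+-suc (suc k) (suc m ∸ k)) (cong (λ j → suc (suc j)) (ℕP.m+[n∸m]≡n (ℕP.≤-pred k≤1+m)))
  swap : ∀ a b c → a * b * c ≡ a * c * b
  swap = ring-solve-∀ ℚ-ring

∫₀¹-ΣBB′ : ∀ m → ∫₀¹ (suc (suc (suc m))) (ΣBB′ (suc (suc m))) ≡ frac 2 (suc (suc (suc (suc m)))) * B (suc (suc m))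
∫₀¹-ΣBB′ m = begin
  ∫₀¹ N (ΣBB′ n)
    ≡⟨ pairing-linear N α (ι N) (λ i → Σ< (suc m) (λ l → c l * bern l i)) (bern n) _ ⟩
  α * ∫₀¹ N (λ i → Σ< (suc m) (λ l → c l * bern l i)) + ι N * ∫₀¹ N (bern n)
    ≡⟨ cong₂ (λ s t → α * s + ι N * t) (pairing-Σ< N (suc m) (λ l i → c l * bern l i) _) (∫₀¹-bern-suc (suc m) N ℕP.≤-refl) ⟩
  α * Σ< (suc m) (λ l → ∫₀¹ N (λ i → c l * bern l i)) + ι N * 0ℚ
    ≡⟨ cong (λ s → α * s + ι N * 0ℚ) (trans (Σ<-cong′ (suc m) (λ l → pairing-scale N (c l) (bern l) _)) (Σ<-head m _)) ⟩
  α * (c 0 * ∫₀¹ N (bern 0) + Σ< m (λ l → c (suc l) * ∫₀¹ N (bern (suc l)))) + ι N * 0ℚ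
    ≡⟨ cong₂ (λ s t → α * (c 0 * s + t) + ι N * 0ℚ) (∫₀¹-bern-0 n) (Σ<-zero m higher) ⟩
  α * (B n * 1ℚ * 1ℚ + 0ℚ) + ι N * 0ℚ
    ≡⟨ simplify α (B n) (ι N) ⟩
  α * B n ∎
  where
  n = suc (suc m)
  N = suc n
  α = frac 2 (suc N)
  c : ℕ → ℚ
  c l = B (n ∸ l) * ι (suc N C l)
  higher : ∀ l → l ℕ.< m → c (suc l) * ∫₀¹ N (bern (suc l)) ≡ 0ℚ
  higher l l<m = trans (cong (c (suc l) *_) (∫₀¹-bern-suc l N (s≤s (s≤s (ℕP.m≤n⇒m≤1+n (ℕP.<⇒≤ l<m))))))
    (*-zeroʳ (c (suc l)))
  simplify : ∀ a b g → a * (b * 1ℚ * 1ℚ + 0ℚ) + g * 0ℚ ≡ a * b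
  simplify = ring-solve-∀ ℚ-ring

∂-cancel : ∀ {p q} i → ∂ p i ≡ ∂ q i → p (suc i) ≡ q (suc i)
∂-cancel {p} {q} i eq = *ι-cancelʳ (suc i) (trans (*-comm (p (suc i)) _) (trans eq (*-comm _ (q (suc i)))))

∫₀¹-determines-constant : ∀ N {p q} → (∀ i → p (suc i) ≡ q (suc i)) → ∫₀¹ (suc N) p ≡ ∫₀¹ (suc N) q → p 0 ≡ q 0
∫₀¹-determines-constant N {p} {q} tail ∫p≡∫q = begin
  p 0             ≡⟨ *-identityʳ (p 0) ⟨
  p 0 * 1ℚ        ≡⟨ +-cancelʳ rest _ _ (trans (sym (Σ<-head N _)) (trans ∫p≡∫q (trans (Σ<-head N _) (cong (q 0 * 1ℚ +_) (sym restEq))))) ⟩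
  q 0 * 1ℚ        ≡⟨ *-identityʳ (q 0) ⟩
  q 0             ∎
  where
  rest = Σ< N (λ i → p (suc i) * frac 1 (suc (suc i)))
  restEq : rest ≡ Σ< N (λ i → q (suc i) * frac 1 (suc (suc i)))
  restEq = Σ<-cong′ N (λ i → cong (_* frac 1 (suc (suc i))) (tail i))

ΣBB≡ΣBB′ : ∀ n i → ΣBB n i ≡ ΣBB′ n i
ΣBB≡ΣBB′-suc : ∀ n i → ΣBB n (suc i) ≡ ΣBB′ n (suc i)

ΣBB≡ΣBB′ zero          zero    = refl
ΣBB≡ΣBB′ (suc zero)    zero    = refl
ΣBB≡ΣBB′ (suc (suc m)) zero    =
  ∫₀¹-determines-constant (suc (suc m)) {ΣBB (suc (suc m))} {ΣBB′ (suc (suc m))} (ΣBB≡ΣBB′-suc (suc (suc m))) (trans (∫₀¹-ΣBB m) (sym (∫₀¹-ΣBB′ m)))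
ΣBB≡ΣBB′ n             (suc i) = ΣBB≡ΣBB′-suc n i

ΣBB≡ΣBB′-suc zero    i = begin
  0ℚ + (bern 0 ⊗ bern 0) (suc i)         ≡⟨ +-identityˡ _ ⟩
  (bern 0 ⊗ bern 0) (suc i)              ≡⟨ ⊗-identityˡ (bern 0) bern-0 (suc i) ⟩
  bern 0 (suc i)                         ≡⟨ trans (*-identityˡ _) (+-identityˡ _) ⟨
  0ℚ + 1ℚ * bern 0 (suc i)               ∎
ΣBB≡ΣBB′-suc (suc n) i = ∂-cancel {ΣBB (suc n)} {ΣBB′ (suc n)} i (begin
  ∂ (ΣBB (suc n)) i                ≡⟨ ∂-ΣBB n i ⟩
  ι (suc (suc n)) * ΣBB n i        ≡⟨ cong (ι (suc (suc n)) *_) (ΣBB≡ΣBB′ n i) ⟩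
  ι (suc (suc n)) * ΣBB′ n i       ≡⟨ ∂-ΣBB′ n i ⟨
  ∂ (ΣBB′ (suc n)) i               ∎)

-- Legendre polynomials

leg : ℕ → ℕ → ℕ
leg k j = (k C j) ℕ.* ((2 ℕ.* k ∸ 2 ℕ.* j) C k)

leg-vanishes : ∀ k j → k ℕ.< 2 ℕ.* j → leg k j ≡ 0
leg-vanishes zero    (suc j) _     = refl
leg-vanishes (suc k) j       k<2j =
  trans (cong ((suc k C j) ℕ.*_) (k>n⇒nCk≡0 small)) (ℕP.*-zeroʳ (suc k C j))
  where
  small : 2 ℕ.* suc k ∸ 2 ℕ.* j ℕ.< suc k
  small = ℕP.m<n+o⇒m∸n<o (2 ℕ.* suc k) (2 ℕ.* j)
    (subst (ℕ._< 2 ℕ.* j ℕ.+ suc k) (double (suc k)) (ℕP.+-monoˡ-< (suc k) k<2j))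
    where
    double : ∀ n → n ℕ.+ n ≡ 2 ℕ.* n
    double = solve-∀

-- leg (2j + r) j = (2j + 2r)! / (j! (j + r)! r!)
legDen legNum : ℕ → ℕ → ℕ
legDen j r = j ! ℕ.* (j ℕ.+ r) ! ℕ.* r !
legNum j r = (j ℕ.+ j ℕ.+ r ℕ.+ r) !

legDen-nonZero : ∀ j r → ℕ.NonZero (legDen j r)
legDen-nonZero j r = ℕP.m*n≢0 (j ! ℕ.* (j ℕ.+ r) !) (r !) {{ℕP._!*_!≢0 j (j ℕ.+ r)}} {{ℕP._!≢0 r}}

[a+b]Ca*[a!*b!]≡[a+b]! : ∀ a b → ((a ℕ.+ b) C a) ℕ.* (a ! ℕ.* b !) ≡ (a ℕ.+ b) !
[a+b]Ca*[a!*b!]≡[a+b]! a b = subst (λ c → ((a ℕ.+ b) C a) ℕ.* (a ! ℕ.* c !) ≡ (a ℕ.+ b) !)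
  (ℕP.m+n∸m≡n a b) (nCk*[k!*[n∸k]!]≡n! (a ℕ.+ b) a (ℕP.m≤m+n a b))

leg*legDen≡legNum : ∀ {k} j r → k ≡ j ℕ.+ j ℕ.+ r → leg k j ℕ.* legDen j r ≡ legNum j r
leg*legDen≡legNum j r refl = begin
  (K C j) ℕ.* ((2 ℕ.* K ∸ 2 ℕ.* j) C K) ℕ.* legDen j r     ≡⟨ cong (λ m → (K C j) ℕ.* (m C K) ℕ.* legDen j r) twiceK∸twicej ⟩
  (K C j) ℕ.* ((K ℕ.+ r) C K) ℕ.* legDen j r              ≡⟨ regroup (K C j) ((K ℕ.+ r) C K) (j !) ((j ℕ.+ r) !) (r !) ⟩
  (K C j) ℕ.* (j ! ℕ.* (j ℕ.+ r) !) ℕ.* ((K ℕ.+ r) C K) ℕ.* r !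
                                                           ≡⟨ cong (λ t → t ℕ.* ((K ℕ.+ r) C K) ℕ.* r !) Kfactorial ⟩
  K ! ℕ.* ((K ℕ.+ r) C K) ℕ.* r !                          ≡⟨ regroup′ (K !) ((K ℕ.+ r) C K) (r !) ⟩
  ((K ℕ.+ r) C K) ℕ.* (K ! ℕ.* r !)                        ≡⟨ [a+b]Ca*[a!*b!]≡[a+b]! K r ⟩
  legNum j r                                               ∎
  where
  K = j ℕ.+ j ℕ.+ r
  twiceK∸twicej : 2 ℕ.* K ∸ 2 ℕ.* j ≡ K ℕ.+ r
  twiceK∸twicej = trans (cong (_∸ 2 ℕ.* j) (split j r)) (ℕP.m+n∸m≡n (2 ℕ.* j) (K ℕ.+ r))
    where
    split : ∀ j r → 2 ℕ.* (j ℕ.+ j ℕ.+ r) ≡ 2 ℕ.* j ℕ.+ (j ℕ.+ j ℕ.+ r ℕ.+ r)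
    split = solve-∀
  Kfactorial : (K C j) ℕ.* (j ! ℕ.* (j ℕ.+ r) !) ≡ K !
  Kfactorial = subst (λ n → (n C j) ℕ.* (j ! ℕ.* (j ℕ.+ r) !) ≡ n !) (sym (ℕP.+-assoc j j r)) ([a+b]Ca*[a!*b!]≡[a+b]! j (j ℕ.+ r))
  regroup : ∀ c₁ c₂ a b c → c₁ ℕ.* c₂ ℕ.* (a ℕ.* b ℕ.* c) ≡ c₁ ℕ.* (a ℕ.* b) ℕ.* c₂ ℕ.* c
  regroup = solve-∀
  regroup′ : ∀ f c d → f ℕ.* c ℕ.* d ≡ c ℕ.* (f ℕ.* d)
  regroup′ = solve-∀

legDen-sucˡ : ∀ j r → legDen (suc j) r ≡ legDen j r ℕ.* (suc j ℕ.* suc (j ℕ.+ r))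
legDen-sucˡ j r = regroup (suc j) (suc (j ℕ.+ r)) (j !) ((j ℕ.+ r) !) (r !)
  where
  regroup : ∀ a b I U R → a ℕ.* I ℕ.* (b ℕ.* U) ℕ.* R ≡ I ℕ.* U ℕ.* R ℕ.* (a ℕ.* b)
  regroup = solve-∀

legDen-sucʳ : ∀ j r → legDen j (suc r) ≡ legDen j r ℕ.* (suc (j ℕ.+ r) ℕ.* suc r)
legDen-sucʳ j r = trans (cong (λ m → j ! ℕ.* m ! ℕ.* suc r !) (ℕP.+-suc j r))
  (regroup (suc (j ℕ.+ r)) (suc r) (j !) ((j ℕ.+ r) !) (r !))
  where
  regroup : ∀ a b I U R → I ℕ.* (a ℕ.* U) ℕ.* (b ℕ.* R) ≡ I ℕ.* U ℕ.* R ℕ.* (a ℕ.* b)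
  regroup = solve-∀

legNum-sucʳ : ∀ j r → legNum j (suc r) ≡ suc (suc (j ℕ.+ j ℕ.+ r ℕ.+ r)) ℕ.* (suc (j ℕ.+ j ℕ.+ r ℕ.+ r) ℕ.* legNum j r)
legNum-sucʳ j r = cong _! (index j r)
  where
  index : ∀ j r → j ℕ.+ j ℕ.+ suc r ℕ.+ suc r ≡ suc (suc (j ℕ.+ j ℕ.+ r ℕ.+ r))
  index = solve-∀

legNum-sucˡ : ∀ j r → legNum (suc j) r ≡ legNum j (suc r)
legNum-sucˡ j r = cong _! (index j r)
  where
  index : ∀ j r → suc j ℕ.+ suc j ℕ.+ r ℕ.+ r ≡ j ℕ.+ j ℕ.+ suc r ℕ.+ suc r
  index = solve-∀

LegRecurrence : ℕ → ℕ → Set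
LegRecurrence k j = (2 ℕ.+ k) ℕ.* leg (2 ℕ.+ k) (suc j)
                  ≡ 2 ℕ.* (3 ℕ.+ 2 ℕ.* k) ℕ.* leg (1 ℕ.+ k) (suc j) ℕ.+ 4 ℕ.* (1 ℕ.+ k) ℕ.* leg k j

-- Both sides are compared after multiplying by legDen (suc j) r, which turns every leg into a legNum.
leg-recurrence-2j : ∀ j → LegRecurrence (j ℕ.+ j ℕ.+ 0) j
leg-recurrence-2j j = ℕP.*-cancelʳ-≡ _ _ D {{legDen-nonZero (suc j) 0}} (begin
  (2 ℕ.+ k) ℕ.* leg (2 ℕ.+ k) (suc j) ℕ.* D                    ≡⟨ ℕP.*-assoc (2 ℕ.+ k) (leg (2 ℕ.+ k) (suc j)) D ⟩
  (2 ℕ.+ k) ℕ.* (leg (2 ℕ.+ k) (suc j) ℕ.* D)                  ≡⟨ cong ((2 ℕ.+ k) ℕ.*_) (leg*legDen≡legNum (suc j) 0 (index₁ j)) ⟩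
  (2 ℕ.+ k) ℕ.* legNum (suc j) 0                              ≡⟨ cong ((2 ℕ.+ k) ℕ.*_) (trans (legNum-sucˡ j 0) (legNum-sucʳ j 0)) ⟩
  (2 ℕ.+ k) ℕ.* (suc (suc X) ℕ.* (suc X ℕ.* G))               ≡⟨ identity j G D ⟩
  b ℕ.* 0 ℕ.* D ℕ.+ c ℕ.* (G ℕ.* (suc j ℕ.* suc (j ℕ.+ 0)))     ≡⟨ cong₂ (λ u v → b ℕ.* u ℕ.* D ℕ.+ c ℕ.* v) (sym middle) (sym last) ⟩
  b ℕ.* leg (1 ℕ.+ k) (suc j) ℕ.* D ℕ.+ c ℕ.* (leg k j ℕ.* D)   ≡⟨ cong (b ℕ.* leg (1 ℕ.+ k) (suc j) ℕ.* D ℕ.+_) (ℕP.*-assoc c (leg k j) D) ⟨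
  b ℕ.* leg (1 ℕ.+ k) (suc j) ℕ.* D ℕ.+ c ℕ.* leg k j ℕ.* D     ≡⟨ ℕP.*-distribʳ-+ D (b ℕ.* leg (1 ℕ.+ k) (suc j)) (c ℕ.* leg k j) ⟨
  (b ℕ.* leg (1 ℕ.+ k) (suc j) ℕ.+ c ℕ.* leg k j) ℕ.* D       ∎)
  where
  k = j ℕ.+ j ℕ.+ 0
  X = j ℕ.+ j ℕ.+ 0 ℕ.+ 0
  D = legDen (suc j) 0
  G = legNum j 0
  b = 2 ℕ.* (3 ℕ.+ 2 ℕ.* k)
  c = 4 ℕ.* (1 ℕ.+ k)
  index₁ : ∀ j → 2 ℕ.+ (j ℕ.+ j ℕ.+ 0) ≡ suc j ℕ.+ suc j ℕ.+ 0
  index₁ = solve-∀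
  middle : leg (1 ℕ.+ k) (suc j) ≡ 0
  middle = leg-vanishes (1 ℕ.+ k) (suc j) (ℕP.≤-reflexive (index j))
    where
    index : ∀ j → 2 ℕ.+ (j ℕ.+ j ℕ.+ 0) ≡ 2 ℕ.* suc j
    index = solve-∀
  last : leg k j ℕ.* D ≡ G ℕ.* (suc j ℕ.* suc (j ℕ.+ 0))
  last = trans (cong (leg k j ℕ.*_) (legDen-sucˡ j 0)) (trans (sym (ℕP.*-assoc (leg k j) (legDen j 0) (suc j ℕ.* suc (j ℕ.+ 0))))
    (cong (ℕ._* (suc j ℕ.* suc (j ℕ.+ 0))) (leg*legDen≡legNum j 0 refl)))
  identity : ∀ j G D → (2 ℕ.+ (j ℕ.+ j ℕ.+ 0)) ℕ.* (suc (suc (j ℕ.+ j ℕ.+ 0 ℕ.+ 0)) ℕ.* (suc (j ℕ.+ j ℕ.+ 0 ℕ.+ 0) ℕ.* G))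
    ≡ 2 ℕ.* (3 ℕ.+ 2 ℕ.* (j ℕ.+ j ℕ.+ 0)) ℕ.* 0 ℕ.* D ℕ.+ 4 ℕ.* (1 ℕ.+ (j ℕ.+ j ℕ.+ 0)) ℕ.* (G ℕ.* (suc j ℕ.* suc (j ℕ.+ 0)))
  identity = solve-∀

leg-recurrence-2j+1+r : ∀ j r → LegRecurrence (j ℕ.+ j ℕ.+ suc r) j
leg-recurrence-2j+1+r j r = ℕP.*-cancelʳ-≡ _ _ D {{legDen-nonZero (suc j) (suc r)}} (begin
  (2 ℕ.+ k) ℕ.* leg (2 ℕ.+ k) (suc j) ℕ.* D                    ≡⟨ ℕP.*-assoc (2 ℕ.+ k) (leg (2 ℕ.+ k) (suc j)) D ⟩
  (2 ℕ.+ k) ℕ.* (leg (2 ℕ.+ k) (suc j) ℕ.* D)                  ≡⟨ cong ((2 ℕ.+ k) ℕ.*_) (leg*legDen≡legNum (suc j) (suc r) (index₁ j r)) ⟩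
  (2 ℕ.+ k) ℕ.* legNum (suc j) (suc r)                        ≡⟨ cong ((2 ℕ.+ k) ℕ.*_) (legNum-sucʳ (suc j) r) ⟩
  (2 ℕ.+ k) ℕ.* (suc (suc X) ℕ.* (suc X ℕ.* G))               ≡⟨ identity j r G ⟩
  b ℕ.* (G ℕ.* s₂) ℕ.+ c ℕ.* (G ℕ.* s₃)                       ≡⟨ cong₂ (λ u v → b ℕ.* u ℕ.+ c ℕ.* v) (sym middle) (sym last) ⟩
  b ℕ.* (leg (1 ℕ.+ k) (suc j) ℕ.* D) ℕ.+ c ℕ.* (leg k j ℕ.* D) ≡⟨ distrib b c (leg (1 ℕ.+ k) (suc j)) (leg k j) D ⟩
  (b ℕ.* leg (1 ℕ.+ k) (suc j) ℕ.+ c ℕ.* leg k j) ℕ.* D       ∎)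
  where
  k = j ℕ.+ j ℕ.+ suc r
  X = suc j ℕ.+ suc j ℕ.+ r ℕ.+ r
  D = legDen (suc j) (suc r)
  G = legNum (suc j) r
  b = 2 ℕ.* (3 ℕ.+ 2 ℕ.* k)
  c = 4 ℕ.* (1 ℕ.+ k)
  s₂ = suc (suc j ℕ.+ r) ℕ.* suc r
  s₃ = suc j ℕ.* suc (j ℕ.+ suc r)
  index₁ : ∀ j r → 2 ℕ.+ (j ℕ.+ j ℕ.+ suc r) ≡ suc j ℕ.+ suc j ℕ.+ suc r
  index₁ = solve-∀
  index₂ : ∀ j r → 1 ℕ.+ (j ℕ.+ j ℕ.+ suc r) ≡ suc j ℕ.+ suc j ℕ.+ r
  index₂ = solve-∀
  middle : leg (1 ℕ.+ k) (suc j) ℕ.* D ≡ G ℕ.* s₂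
  middle = trans (cong (leg (1 ℕ.+ k) (suc j) ℕ.*_) (legDen-sucʳ (suc j) r)) (trans (sym (ℕP.*-assoc (leg (1 ℕ.+ k) (suc j)) (legDen (suc j) r) s₂))
    (cong (ℕ._* s₂) (leg*legDen≡legNum (suc j) r (index₂ j r))))
  last : leg k j ℕ.* D ≡ G ℕ.* s₃
  last = trans (cong (leg k j ℕ.*_) (legDen-sucˡ j (suc r))) (trans (sym (ℕP.*-assoc (leg k j) (legDen j (suc r)) s₃))
    (cong (ℕ._* s₃) (trans (leg*legDen≡legNum j (suc r) refl) (sym (legNum-sucˡ j r)))))
  identity : ∀ j r G → (2 ℕ.+ (j ℕ.+ j ℕ.+ suc r)) ℕ.* (suc (suc (suc j ℕ.+ suc j ℕ.+ r ℕ.+ r)) ℕ.* (suc (suc j ℕ.+ suc j ℕ.+ r ℕ.+ r) ℕ.* G))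
    ≡ 2 ℕ.* (3 ℕ.+ 2 ℕ.* (j ℕ.+ j ℕ.+ suc r)) ℕ.* (G ℕ.* (suc (suc j ℕ.+ r) ℕ.* suc r))
      ℕ.+ 4 ℕ.* (1 ℕ.+ (j ℕ.+ j ℕ.+ suc r)) ℕ.* (G ℕ.* (suc j ℕ.* suc (j ℕ.+ suc r)))
  identity = solve-∀
  distrib : ∀ b c u v D → b ℕ.* (u ℕ.* D) ℕ.+ c ℕ.* (v ℕ.* D) ≡ (b ℕ.* u ℕ.+ c ℕ.* v) ℕ.* D
  distrib = solve-∀

leg-recurrence-diagonal : ∀ j r → LegRecurrence (j ℕ.+ j ℕ.+ r) j
leg-recurrence-diagonal j zero    = leg-recurrence-2j j
leg-recurrence-diagonal j (suc r) = leg-recurrence-2j+1+r j r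

leg-recurrence : ∀ k j → LegRecurrence k j
leg-recurrence k j with j ℕ.+ j ℕ.≤? k
... | yes 2j≤k = subst (λ k → LegRecurrence k j) (proj₂ (ℕP.m≤n⇒∃[o]m+o≡n 2j≤k)) (leg-recurrence-diagonal j _)
... | no  2j≰k = begin
  (2 ℕ.+ k) ℕ.* leg (2 ℕ.+ k) (suc j)                          ≡⟨ cong ((2 ℕ.+ k) ℕ.*_) vanishes₂ ⟩
  (2 ℕ.+ k) ℕ.* 0                                             ≡⟨ zeros (2 ℕ.+ k) (2 ℕ.* (3 ℕ.+ 2 ℕ.* k)) (4 ℕ.* (1 ℕ.+ k)) ⟩
  2 ℕ.* (3 ℕ.+ 2 ℕ.* k) ℕ.* 0 ℕ.+ 4 ℕ.* (1 ℕ.+ k) ℕ.* 0        ≡⟨ cong₂ (λ u v → 2 ℕ.* (3 ℕ.+ 2 ℕ.* k) ℕ.* u ℕ.+ 4 ℕ.* (1 ℕ.+ k) ℕ.* v) (sym vanishes₁) (sym vanishes₀) ⟩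
  2 ℕ.* (3 ℕ.+ 2 ℕ.* k) ℕ.* leg (1 ℕ.+ k) (suc j) ℕ.+ 4 ℕ.* (1 ℕ.+ k) ℕ.* leg k j ∎
  where
  k<2j : k ℕ.< j ℕ.+ j
  k<2j = ℕP.≰⇒> 2j≰k
  twice : ∀ j → j ℕ.+ j ≡ 2 ℕ.* j
  twice = solve-∀
  twice-suc : ∀ j → 2 ℕ.+ (j ℕ.+ j) ≡ 2 ℕ.* suc j
  twice-suc = solve-∀
  vanishes₂ = leg-vanishes (2 ℕ.+ k) (suc j) (ℕP.≤-trans (s≤s (s≤s k<2j)) (ℕP.≤-reflexive (twice-suc j)))
  vanishes₁ = leg-vanishes (1 ℕ.+ k) (suc j) (ℕP.≤-trans (s≤s (ℕP.m≤n⇒m≤1+n k<2j)) (ℕP.≤-reflexive (twice-suc j)))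
  vanishes₀ = leg-vanishes k j (ℕP.≤-trans k<2j (ℕP.≤-reflexive (twice j)))
  zeros : ∀ a b c → a ℕ.* 0 ≡ b ℕ.* 0 ℕ.+ c ℕ.* 0
  zeros = solve-∀

leg-recurrence-0 : ∀ k → (2 ℕ.+ k) ℕ.* leg (2 ℕ.+ k) 0 ≡ 2 ℕ.* (3 ℕ.+ 2 ℕ.* k) ℕ.* leg (1 ℕ.+ k) 0
leg-recurrence-0 k = ℕP.*-cancelʳ-≡ _ _ D {{legDen-nonZero 0 (2 ℕ.+ k)}} (begin
  (2 ℕ.+ k) ℕ.* leg (2 ℕ.+ k) 0 ℕ.* D                ≡⟨ ℕP.*-assoc (2 ℕ.+ k) (leg (2 ℕ.+ k) 0) D ⟩
  (2 ℕ.+ k) ℕ.* (leg (2 ℕ.+ k) 0 ℕ.* D)              ≡⟨ cong ((2 ℕ.+ k) ℕ.*_) (leg*legDen≡legNum 0 (2 ℕ.+ k) refl) ⟩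
  (2 ℕ.+ k) ℕ.* legNum 0 (2 ℕ.+ k)                  ≡⟨ cong ((2 ℕ.+ k) ℕ.*_) (legNum-sucʳ 0 (1 ℕ.+ k)) ⟩
  (2 ℕ.+ k) ℕ.* (suc (suc X) ℕ.* (suc X ℕ.* G))     ≡⟨ identity k G ⟩
  b ℕ.* (G ℕ.* s)                                   ≡⟨ cong (b ℕ.*_) lower ⟨
  b ℕ.* (leg (1 ℕ.+ k) 0 ℕ.* D)                     ≡⟨ ℕP.*-assoc b (leg (1 ℕ.+ k) 0) D ⟨
  b ℕ.* leg (1 ℕ.+ k) 0 ℕ.* D                       ∎)
  where
  D = legDen 0 (2 ℕ.+ k)
  G = legNum 0 (1 ℕ.+ k)
  X = 0 ℕ.+ 0 ℕ.+ (1 ℕ.+ k) ℕ.+ (1 ℕ.+ k)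
  b = 2 ℕ.* (3 ℕ.+ 2 ℕ.* k)
  s = suc (0 ℕ.+ (1 ℕ.+ k)) ℕ.* suc (1 ℕ.+ k)
  lower : leg (1 ℕ.+ k) 0 ℕ.* D ≡ G ℕ.* s
  lower = trans (cong (leg (1 ℕ.+ k) 0 ℕ.*_) (legDen-sucʳ 0 (1 ℕ.+ k)))
    (trans (sym (ℕP.*-assoc (leg (1 ℕ.+ k) 0) (legDen 0 (1 ℕ.+ k)) s)) (cong (ℕ._* s) (leg*legDen≡legNum 0 (1 ℕ.+ k) refl)))
  identity : ∀ k G → (2 ℕ.+ k) ℕ.* (suc (suc (0 ℕ.+ 0 ℕ.+ (1 ℕ.+ k) ℕ.+ (1 ℕ.+ k))) ℕ.* (suc (0 ℕ.+ 0 ℕ.+ (1 ℕ.+ k) ℕ.+ (1 ℕ.+ k)) ℕ.* G))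
    ≡ 2 ℕ.* (3 ℕ.+ 2 ℕ.* k) ℕ.* (G ℕ.* (suc (0 ℕ.+ (1 ℕ.+ k)) ℕ.* suc (1 ℕ.+ k)))
  identity = solve-∀


legTerm : ℚ → ℕ → ℕ → ℚ
legTerm x k j = ((- 1ℚ) ^ℚ j) * ι (leg k j) * (x ^ℚ (k ∸ 2 ℕ.* j))

-- P k x is definitionally frac 1 (2 ^ k) * legSum x k.
legSum : ℚ → ℕ → ℚ
legSum x k = Σ< (suc (k ℕ./ 2)) (legTerm x k)

k<2*[1+k/2] : ∀ k → k ℕ.< 2 ℕ.* suc (k ℕ./ 2)
k<2*[1+k/2] k = ℕP.≤-trans (s≤s (ℕP.≤-trans (ℕP.≤-reflexive (m≡m%n+[m/n]*n k 2)) (ℕP.+-monoˡ-≤ (k ℕ./ 2 ℕ.* 2) (ℕP.≤-pred (m%n<n k 2)))))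
  (ℕP.≤-reflexive (index (k ℕ./ 2)))
  where
  index : ∀ q → suc (1 ℕ.+ q ℕ.* 2) ≡ 2 ℕ.* suc q
  index = solve-∀

legSum-extend : ∀ x k M → suc (k ℕ./ 2) ℕ.≤ M → Σ< M (legTerm x k) ≡ legSum x k
legSum-extend x k M k/2<M = Σ<-truncate (suc (k ℕ./ 2)) M (legTerm x k) k/2<M vanish
  where
  vanish : ∀ j → suc (k ℕ./ 2) ℕ.≤ j → legTerm x k j ≡ 0ℚ
  vanish j k/2<j = begin
    (- 1ℚ) ^ℚ j * ι (leg k j) * x ^ℚ (k ∸ 2 ℕ.* j)   ≡⟨ cong (λ c → (- 1ℚ) ^ℚ j * ι c * x ^ℚ (k ∸ 2 ℕ.* j)) (leg-vanishes k j k<2j) ⟩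
    (- 1ℚ) ^ℚ j * 0ℚ * x ^ℚ (k ∸ 2 ℕ.* j)           ≡⟨ cong (_* x ^ℚ (k ∸ 2 ℕ.* j)) (*-zeroʳ ((- 1ℚ) ^ℚ j)) ⟩
    0ℚ * x ^ℚ (k ∸ 2 ℕ.* j)                        ≡⟨ *-zeroˡ (x ^ℚ (k ∸ 2 ℕ.* j)) ⟩
    0ℚ                                             ∎
    where
    k<2j : k ℕ.< 2 ℕ.* j
    k<2j = ℕP.≤-trans (k<2*[1+k/2] k) (ℕP.*-monoʳ-≤ 2 k/2<j)

x*[c*xⁿ]≡c*xⁿ⁺¹ : ∀ x c n → x * (c * x ^ℚ n) ≡ c * x ^ℚ suc n
x*[c*xⁿ]≡c*xⁿ⁺¹ x c n = rotate x c (x ^ℚ n)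
  where
  rotate : ∀ x c y → x * (c * y) ≡ c * (y * x)
  rotate = ring-solve-∀ ℚ-ring

x*[0*xᵐ]≡0*xⁿ : ∀ x c m n → c ≡ 0ℚ → x * (c * x ^ℚ m) ≡ c * x ^ℚ n
x*[0*xᵐ]≡0*xⁿ x c m n refl = trans (cong (x *_) (*-zeroˡ (x ^ℚ m))) (trans (*-zeroʳ x) (sym (*-zeroˡ (x ^ℚ n))))

-- Either 2j ≤ k and the exponent simply grows, or leg k j = 0.
x*legMonomial : ∀ x k j → x * (ι (leg k j) * x ^ℚ (k ∸ 2 ℕ.* j)) ≡ ι (leg k j) * x ^ℚ (suc k ∸ 2 ℕ.* j)
x*legMonomial x k j = [
  (λ 2j≤k → trans (x*[c*xⁿ]≡c*xⁿ⁺¹ x (ι (leg k j)) (k ∸ 2 ℕ.* j)) (cong (λ e → ι (leg k j) * x ^ℚ e) (sym (ℕP.+-∸-assoc 1 2j≤k)))) ,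
  (λ k<2j → x*[0*xᵐ]≡0*xⁿ x (ι (leg k j)) (k ∸ 2 ℕ.* j) (suc k ∸ 2 ℕ.* j) (cong ι (leg-vanishes k j k<2j))) ]′
  (ℕP.≤-<-connex (2 ℕ.* j) k)

leg-recurrenceℚ : ∀ k j → ι (2 ℕ.+ k) * ι (leg (2 ℕ.+ k) (suc j))
  ≡ ι 2 * ι (suc (2 ℕ.* suc k)) * ι (leg (1 ℕ.+ k) (suc j)) + ι 4 * ι (1 ℕ.+ k) * ι (leg k j)
leg-recurrenceℚ k j = begin
  ι (2 ℕ.+ k) * ι (leg (2 ℕ.+ k) (suc j))                ≡⟨ ι-homo-* (2 ℕ.+ k) (leg (2 ℕ.+ k) (suc j)) ⟨
  ι ((2 ℕ.+ k) ℕ.* leg (2 ℕ.+ k) (suc j))                ≡⟨ cong ι (leg-recurrence k j) ⟩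
  ι (2 ℕ.* (3 ℕ.+ 2 ℕ.* k) ℕ.* leg (1 ℕ.+ k) (suc j) ℕ.+ 4 ℕ.* (1 ℕ.+ k) ℕ.* leg k j)
    ≡⟨ ι-homo-+ (2 ℕ.* (3 ℕ.+ 2 ℕ.* k) ℕ.* leg (1 ℕ.+ k) (suc j)) (4 ℕ.* (1 ℕ.+ k) ℕ.* leg k j) ⟩
  ι (2 ℕ.* (3 ℕ.+ 2 ℕ.* k) ℕ.* leg (1 ℕ.+ k) (suc j)) + ι (4 ℕ.* (1 ℕ.+ k) ℕ.* leg k j)
    ≡⟨ cong₂ _+_ (ι-homo-*₃ 2 (3 ℕ.+ 2 ℕ.* k) (leg (1 ℕ.+ k) (suc j))) (ι-homo-*₃ 4 (1 ℕ.+ k) (leg k j)) ⟩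
  ι 2 * ι (3 ℕ.+ 2 ℕ.* k) * ι (leg (1 ℕ.+ k) (suc j)) + ι 4 * ι (1 ℕ.+ k) * ι (leg k j)
    ≡⟨ cong (λ m → ι 2 * ι m * ι (leg (1 ℕ.+ k) (suc j)) + ι 4 * ι (1 ℕ.+ k) * ι (leg k j)) (index k) ⟩
  ι 2 * ι (suc (2 ℕ.* suc k)) * ι (leg (1 ℕ.+ k) (suc j)) + ι 4 * ι (1 ℕ.+ k) * ι (leg k j) ∎
  where
  index : ∀ k → 3 ℕ.+ 2 ℕ.* k ≡ suc (2 ℕ.* suc k)
  index = solve-∀

leg-recurrence-0ℚ : ∀ k → ι (2 ℕ.+ k) * ι (leg (2 ℕ.+ k) 0) ≡ ι 2 * ι (suc (2 ℕ.* suc k)) * ι (leg (1 ℕ.+ k) 0)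
leg-recurrence-0ℚ k = begin
  ι (2 ℕ.+ k) * ι (leg (2 ℕ.+ k) 0)                  ≡⟨ ι-homo-* (2 ℕ.+ k) (leg (2 ℕ.+ k) 0) ⟨
  ι ((2 ℕ.+ k) ℕ.* leg (2 ℕ.+ k) 0)                  ≡⟨ cong ι (trans (leg-recurrence-0 k) (cong (λ m → 2 ℕ.* m ℕ.* leg (1 ℕ.+ k) 0) (index k))) ⟩
  ι (2 ℕ.* suc (2 ℕ.* suc k) ℕ.* leg (1 ℕ.+ k) 0)    ≡⟨ ι-homo-*₃ 2 (suc (2 ℕ.* suc k)) (leg (1 ℕ.+ k) 0) ⟩
  ι 2 * ι (suc (2 ℕ.* suc k)) * ι (leg (1 ℕ.+ k) 0)  ∎
  where
  index : ∀ k → 3 ℕ.+ 2 ℕ.* k ≡ suc (2 ℕ.* suc k)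
  index = solve-∀

legTerm-recurrence-0 : ∀ x k → ι (2 ℕ.+ k) * legTerm x (2 ℕ.+ k) 0 ≡ ι 2 * ι (suc (2 ℕ.* suc k)) * x * legTerm x (1 ℕ.+ k) 0
legTerm-recurrence-0 x k = begin
  ι (2 ℕ.+ k) * (1ℚ * ι (leg (2 ℕ.+ k) 0) * x ^ℚ (2 ℕ.+ k))
    ≡⟨ pull (ι (2 ℕ.+ k)) (ι (leg (2 ℕ.+ k) 0)) (x ^ℚ (2 ℕ.+ k)) ⟩
  ι (2 ℕ.+ k) * ι (leg (2 ℕ.+ k) 0) * x ^ℚ (2 ℕ.+ k)
    ≡⟨ cong (_* x ^ℚ (2 ℕ.+ k)) (leg-recurrence-0ℚ k) ⟩
  ι 2 * ι (suc (2 ℕ.* suc k)) * ι (leg (1 ℕ.+ k) 0) * x ^ℚ (2 ℕ.+ k)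
    ≡⟨ *-assoc (ι 2 * ι (suc (2 ℕ.* suc k))) (ι (leg (1 ℕ.+ k) 0)) (x ^ℚ (2 ℕ.+ k)) ⟩
  ι 2 * ι (suc (2 ℕ.* suc k)) * (ι (leg (1 ℕ.+ k) 0) * x ^ℚ (2 ℕ.+ k))
    ≡⟨ cong (ι 2 * ι (suc (2 ℕ.* suc k)) *_) (x*legMonomial x (1 ℕ.+ k) 0) ⟨
  ι 2 * ι (suc (2 ℕ.* suc k)) * (x * (ι (leg (1 ℕ.+ k) 0) * x ^ℚ (1 ℕ.+ k)))
    ≡⟨ push (ι 2 * ι (suc (2 ℕ.* suc k))) x (ι (leg (1 ℕ.+ k) 0)) (x ^ℚ (1 ℕ.+ k)) ⟩
  ι 2 * ι (suc (2 ℕ.* suc k)) * x * (1ℚ * ι (leg (1 ℕ.+ k) 0) * x ^ℚ (1 ℕ.+ k)) ∎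
  where
  pull : ∀ a u X → a * (1ℚ * u * X) ≡ a * u * X
  pull = ring-solve-∀ ℚ-ring
  push : ∀ β x u X → β * (x * (u * X)) ≡ β * x * (1ℚ * u * X)
  push = ring-solve-∀ ℚ-ring

-- (−1)ʲ⁺¹ = −(−1)ʲ turns a u = β v + c w into the termwise identity.
sign-combination : ∀ a β c u v w s E → a * u ≡ β * v + c * w →
  a * (s * - 1ℚ * u * E) + c * (s * w * E) ≡ β * (s * - 1ℚ) * (v * E)
sign-combination a β c u v w s E h = begin
  a * (s * - 1ℚ * u * E) + c * (s * w * E)       ≡⟨ expand₁ a u c w s E ⟩
  - (s * E) * (a * u) + c * (s * w * E)           ≡⟨ cong (λ y → - (s * E) * y + c * (s * w * E)) h ⟩
  - (s * E) * (β * v + c * w) + c * (s * w * E)   ≡⟨ expand₂ β v c w s E ⟩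
  β * (s * - 1ℚ) * (v * E)                        ∎
  where
  expand₁ : ∀ a u c w s E → a * (s * - 1ℚ * u * E) + c * (s * w * E) ≡ - (s * E) * (a * u) + c * (s * w * E)
  expand₁ = ring-solve-∀ ℚ-ring
  expand₂ : ∀ β v c w s E → - (s * E) * (β * v + c * w) + c * (s * w * E) ≡ β * (s * - 1ℚ) * (v * E)
  expand₂ = ring-solve-∀ ℚ-ring

legTerm-recurrence : ∀ x k j → ι (2 ℕ.+ k) * legTerm x (2 ℕ.+ k) (suc j) + ι 4 * ι (1 ℕ.+ k) * legTerm x k j
                             ≡ ι 2 * ι (suc (2 ℕ.* suc k)) * x * legTerm x (1 ℕ.+ k) (suc j)
legTerm-recurrence x k j = begin
  ι (2 ℕ.+ k) * ((- 1ℚ) ^ℚ j * - 1ℚ * ι (leg (2 ℕ.+ k) (suc j)) * x ^ℚ (2 ℕ.+ k ∸ 2 ℕ.* suc j))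
    + ι 4 * ι (1 ℕ.+ k) * ((- 1ℚ) ^ℚ j * ι (leg k j) * x ^ℚ (k ∸ 2 ℕ.* j))
    ≡⟨ cong (λ e → ι (2 ℕ.+ k) * ((- 1ℚ) ^ℚ j * - 1ℚ * ι (leg (2 ℕ.+ k) (suc j)) * x ^ℚ e)
                   + ι 4 * ι (1 ℕ.+ k) * ((- 1ℚ) ^ℚ j * ι (leg k j) * x ^ℚ (k ∸ 2 ℕ.* j))) exponent ⟩
  ι (2 ℕ.+ k) * ((- 1ℚ) ^ℚ j * - 1ℚ * ι (leg (2 ℕ.+ k) (suc j)) * x ^ℚ (k ∸ 2 ℕ.* j))
    + ι 4 * ι (1 ℕ.+ k) * ((- 1ℚ) ^ℚ j * ι (leg k j) * x ^ℚ (k ∸ 2 ℕ.* j))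
    ≡⟨ sign-combination (ι (2 ℕ.+ k)) (ι 2 * ι (suc (2 ℕ.* suc k))) (ι 4 * ι (1 ℕ.+ k))
         (ι (leg (2 ℕ.+ k) (suc j))) (ι (leg (1 ℕ.+ k) (suc j))) (ι (leg k j)) ((- 1ℚ) ^ℚ j) (x ^ℚ (k ∸ 2 ℕ.* j)) (leg-recurrenceℚ k j) ⟩
  ι 2 * ι (suc (2 ℕ.* suc k)) * ((- 1ℚ) ^ℚ j * - 1ℚ) * (ι (leg (1 ℕ.+ k) (suc j)) * x ^ℚ (k ∸ 2 ℕ.* j))
    ≡⟨ cong (λ e → ι 2 * ι (suc (2 ℕ.* suc k)) * ((- 1ℚ) ^ℚ j * - 1ℚ) * (ι (leg (1 ℕ.+ k) (suc j)) * x ^ℚ e)) exponent ⟨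
  ι 2 * ι (suc (2 ℕ.* suc k)) * ((- 1ℚ) ^ℚ j * - 1ℚ) * (ι (leg (1 ℕ.+ k) (suc j)) * x ^ℚ (2 ℕ.+ k ∸ 2 ℕ.* suc j))
    ≡⟨ cong (ι 2 * ι (suc (2 ℕ.* suc k)) * ((- 1ℚ) ^ℚ j * - 1ℚ) *_) (x*legMonomial x (1 ℕ.+ k) (suc j)) ⟨
  ι 2 * ι (suc (2 ℕ.* suc k)) * ((- 1ℚ) ^ℚ j * - 1ℚ) * (x * (ι (leg (1 ℕ.+ k) (suc j)) * x ^ℚ (1 ℕ.+ k ∸ 2 ℕ.* suc j)))
    ≡⟨ push (ι 2 * ι (suc (2 ℕ.* suc k))) ((- 1ℚ) ^ℚ j * - 1ℚ) x (ι (leg (1 ℕ.+ k) (suc j))) (x ^ℚ (1 ℕ.+ k ∸ 2 ℕ.* suc j)) ⟩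
  ι 2 * ι (suc (2 ℕ.* suc k)) * x * ((- 1ℚ) ^ℚ j * - 1ℚ * ι (leg (1 ℕ.+ k) (suc j)) * x ^ℚ (1 ℕ.+ k ∸ 2 ℕ.* suc j)) ∎
  where
  exponent : 2 ℕ.+ k ∸ 2 ℕ.* suc j ≡ k ∸ 2 ℕ.* j
  exponent = trans (cong (2 ℕ.+ k ∸_) (index j)) (ℕP.[m+n]∸[m+o]≡n∸o 2 k (2 ℕ.* j))
    where
    index : ∀ j → 2 ℕ.* suc j ≡ 2 ℕ.+ 2 ℕ.* j
    index = solve-∀
  push : ∀ β σ x u X → β * σ * (x * (u * X)) ≡ β * x * (σ * u * X)
  push = ring-solve-∀ ℚ-ring

legSum-recurrence : ∀ x k → ι (2 ℕ.+ k) * legSum x (2 ℕ.+ k) + ι 4 * ι (1 ℕ.+ k) * legSum x k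
                          ≡ ι 2 * ι (suc (2 ℕ.* suc k)) * x * legSum x (1 ℕ.+ k)
legSum-recurrence x k = begin
  a * legSum x (2 ℕ.+ k) + c * legSum x k
    ≡⟨ cong₂ (λ s t → a * s + c * t) (legSum-extend x (2 ℕ.+ k) (3 ℕ.+ k) (s≤s (m/n≤m (2 ℕ.+ k) 2)))
                                    (legSum-extend x k (2 ℕ.+ k) (s≤s (ℕP.m≤n⇒m≤1+n (m/n≤m k 2)))) ⟨
  a * Σ< (3 ℕ.+ k) (legTerm x (2 ℕ.+ k)) + c * Σ< (2 ℕ.+ k) (legTerm x k)
    ≡⟨ cong (λ s → a * s + c * Σ< (2 ℕ.+ k) (legTerm x k)) (Σ<-head (2 ℕ.+ k) (legTerm x (2 ℕ.+ k))) ⟩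
  a * (legTerm x (2 ℕ.+ k) 0 + Σ< (2 ℕ.+ k) (λ j → legTerm x (2 ℕ.+ k) (suc j))) + c * Σ< (2 ℕ.+ k) (legTerm x k)
    ≡⟨ regroup a (legTerm x (2 ℕ.+ k) 0) (Σ< (2 ℕ.+ k) (λ j → legTerm x (2 ℕ.+ k) (suc j))) c (Σ< (2 ℕ.+ k) (legTerm x k)) ⟩
  a * legTerm x (2 ℕ.+ k) 0 + (a * Σ< (2 ℕ.+ k) (λ j → legTerm x (2 ℕ.+ k) (suc j)) + c * Σ< (2 ℕ.+ k) (legTerm x k))
    ≡⟨ cong (a * legTerm x (2 ℕ.+ k) 0 +_)
            (trans (cong₂ _+_ (*-distribˡ-Σ< (2 ℕ.+ k) a (λ j → legTerm x (2 ℕ.+ k) (suc j))) (*-distribˡ-Σ< (2 ℕ.+ k) c (legTerm x k)))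
                   (sym (Σ<-distrib-+ (2 ℕ.+ k) (λ j → a * legTerm x (2 ℕ.+ k) (suc j)) (λ j → c * legTerm x k j)))) ⟩
  a * legTerm x (2 ℕ.+ k) 0 + Σ< (2 ℕ.+ k) (λ j → a * legTerm x (2 ℕ.+ k) (suc j) + c * legTerm x k j)
    ≡⟨ cong₂ _+_ (legTerm-recurrence-0 x k) (Σ<-cong′ (2 ℕ.+ k) (legTerm-recurrence x k)) ⟩
  b * legTerm x (1 ℕ.+ k) 0 + Σ< (2 ℕ.+ k) (λ j → b * legTerm x (1 ℕ.+ k) (suc j))
    ≡⟨ trans (cong (b * legTerm x (1 ℕ.+ k) 0 +_) (sym (*-distribˡ-Σ< (2 ℕ.+ k) b (λ j → legTerm x (1 ℕ.+ k) (suc j)))))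
             (sym (*-distribˡ-+ b (legTerm x (1 ℕ.+ k) 0) (Σ< (2 ℕ.+ k) (λ j → legTerm x (1 ℕ.+ k) (suc j))))) ⟩
  b * (legTerm x (1 ℕ.+ k) 0 + Σ< (2 ℕ.+ k) (λ j → legTerm x (1 ℕ.+ k) (suc j)))
    ≡⟨ cong (b *_) (trans (sym (Σ<-head (2 ℕ.+ k) (legTerm x (1 ℕ.+ k))))
                          (legSum-extend x (1 ℕ.+ k) (3 ℕ.+ k) (s≤s (ℕP.m≤n⇒m≤1+n (m/n≤m (1 ℕ.+ k) 2))))) ⟩
  b * legSum x (1 ℕ.+ k) ∎
  where
  a = ι (2 ℕ.+ k)
  c = ι 4 * ι (1 ℕ.+ k)
  b = ι 2 * ι (suc (2 ℕ.* suc k)) * x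
  regroup : ∀ a A S c T → a * (A + S) + c * T ≡ a * A + (a * S + c * T)
  regroup = ring-solve-∀ ℚ-ring

P*2^k≡legSum : ∀ x k → P k x * ι (2 ℕ.^ k) ≡ legSum x k
P*2^k≡legSum x k = begin
  frac 1 (2 ℕ.^ k) * legSum x k * ι (2 ℕ.^ k)     ≡⟨ swap (frac 1 (2 ℕ.^ k)) (legSum x k) (ι (2 ℕ.^ k)) ⟩
  legSum x k * (frac 1 (2 ℕ.^ k) * ι (2 ℕ.^ k))   ≡⟨ cong (legSum x k *_) (frac-*-ι 1 (2 ℕ.^ k) {{ℕP.m^n≢0 2 k}}) ⟩
  legSum x k * 1ℚ                                ≡⟨ *-identityʳ (legSum x k) ⟩
  legSum x k                                     ∎
  where
  swap : ∀ f s w → f * s * w ≡ s * (f * w)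
  swap = ring-solve-∀ ℚ-ring

-- Bonnet's recurrence; multiplied by 2ᵏ⁺¹ it is legSum-recurrence.
P-recurrence : ∀ x k → ι (suc k) * P (suc k) x + ι k * P (k ∸ 1) x ≡ ι (suc (2 ℕ.* k)) * x * P k x
P-recurrence x zero    = base x
  where
  base : ∀ x → 1ℚ * (frac 1 2 * (0ℚ + 1ℚ * ι 2 * (1ℚ * x))) + 0ℚ * (1ℚ * (0ℚ + 1ℚ * 1ℚ * 1ℚ))
             ≡ 1ℚ * x * (1ℚ * (0ℚ + 1ℚ * 1ℚ * 1ℚ))
  base = ring-solve-∀ ℚ-ring
P-recurrence x (suc k) = *ι-cancelʳ (2 ℕ.^ (2 ℕ.+ k)) {{ℕP.m^n≢0 2 (2 ℕ.+ k)}} (begin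
  (ι (2 ℕ.+ k) * P (2 ℕ.+ k) x + ι (1 ℕ.+ k) * P k x) * W₂
    ≡⟨ cong (λ w → (ι (2 ℕ.+ k) * P (2 ℕ.+ k) x + ι (1 ℕ.+ k) * P k x) * w) W₂≡ ⟩
  (ι (2 ℕ.+ k) * P (2 ℕ.+ k) x + ι (1 ℕ.+ k) * P k x) * (ι 2 * (ι 2 * W₀))
    ≡⟨ expand (ι (2 ℕ.+ k)) (P (2 ℕ.+ k) x) (ι (1 ℕ.+ k)) (P k x) W₀ ⟩
  ι (2 ℕ.+ k) * (P (2 ℕ.+ k) x * (ι 2 * (ι 2 * W₀))) + ι 4 * ι (1 ℕ.+ k) * (P k x * W₀)
    ≡⟨ cong₂ (λ u v → ι (2 ℕ.+ k) * u + ι 4 * ι (1 ℕ.+ k) * v)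
             (trans (cong (P (2 ℕ.+ k) x *_) (sym W₂≡)) (P*2^k≡legSum x (2 ℕ.+ k))) (P*2^k≡legSum x k) ⟩
  ι (2 ℕ.+ k) * legSum x (2 ℕ.+ k) + ι 4 * ι (1 ℕ.+ k) * legSum x k
    ≡⟨ legSum-recurrence x k ⟩
  ι 2 * ι (suc (2 ℕ.* suc k)) * x * legSum x (1 ℕ.+ k)
    ≡⟨ cong (ι 2 * ι (suc (2 ℕ.* suc k)) * x *_) (P*2^k≡legSum x (1 ℕ.+ k)) ⟨
  ι 2 * ι (suc (2 ℕ.* suc k)) * x * (P (1 ℕ.+ k) x * W₁)
    ≡⟨ collect (ι (suc (2 ℕ.* suc k))) x (P (1 ℕ.+ k) x) W₁ ⟩
  ι (suc (2 ℕ.* suc k)) * x * P (1 ℕ.+ k) x * (ι 2 * W₁)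
    ≡⟨ cong (ι (suc (2 ℕ.* suc k)) * x * P (1 ℕ.+ k) x *_) (ι-homo-* 2 (2 ℕ.^ (1 ℕ.+ k))) ⟨
  ι (suc (2 ℕ.* suc k)) * x * P (1 ℕ.+ k) x * W₂ ∎)
  where
  W₀ = ι (2 ℕ.^ k)
  W₁ = ι (2 ℕ.^ (1 ℕ.+ k))
  W₂ = ι (2 ℕ.^ (2 ℕ.+ k))
  W₂≡ : W₂ ≡ ι 2 * (ι 2 * W₀)
  W₂≡ = trans (ι-homo-* 2 (2 ℕ.^ (1 ℕ.+ k))) (cong (ι 2 *_) (ι-homo-* 2 (2 ℕ.^ k)))
  expand : ∀ a p c q w → (a * p + c * q) * (ι 2 * (ι 2 * w)) ≡ a * (p * (ι 2 * (ι 2 * w))) + ι 4 * c * (q * w)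
  expand = ring-solve-∀ ℚ-ring
  collect : ∀ d x p w → ι 2 * d * x * (p * w) ≡ d * x * p * (ι 2 * w)
  collect = ring-solve-∀ ℚ-ring

-- The coefficients F j k

-- F (k + 2s) k = (k + 2s)! (k + s + 1)! / (s! (2k + 2s + 2)!)
Fnum Fden : ℕ → ℕ → ℕ
Fnum k s = (k ℕ.+ (s ℕ.+ s)) ! ℕ.* (suc (k ℕ.+ s)) !
Fden k s = s ! ℕ.* (suc (suc (k ℕ.+ (s ℕ.+ s) ℕ.+ k))) !

Fden-nonZero : ∀ k s → ℕ.NonZero (Fden k s)
Fden-nonZero k s = ℕP._!*_!≢0 s (suc (suc (k ℕ.+ (s ℕ.+ s) ℕ.+ k)))

data Offset (k j : ℕ) : Set where
  below : j ℕ.< k → Offset k j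
  even  : ∀ s → j ≡ k ℕ.+ (s ℕ.+ s) → Offset k j
  odd   : ∀ s → j ≡ k ℕ.+ suc (s ℕ.+ s) → Offset k j

parity : ∀ d → Σ ℕ (λ s → d ≡ s ℕ.+ s) ⊎ Σ ℕ (λ s → d ≡ suc (s ℕ.+ s))
parity zero          = inj₁ (0 , refl)
parity (suc zero)    = inj₂ (0 , refl)
parity (suc (suc d)) with parity d
... | inj₁ (s , d≡2s)   = inj₁ (suc s , cong suc (trans (cong suc d≡2s) (sym (ℕP.+-suc s s))))
... | inj₂ (s , d≡2s+1) = inj₂ (suc s , cong (λ t → suc (suc t)) (trans d≡2s+1 (sym (ℕP.+-suc s s))))

offset : ∀ k j → Offset k j
offset k j with j ℕ.<? k
... | yes j<k = below j<k
... | no  j≮k with parity (j ∸ k)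
...   | inj₁ (s , eq) = even s (trans (sym (ℕP.m+[n∸m]≡n (ℕP.≮⇒≥ j≮k))) (cong (k ℕ.+_) eq))
...   | inj₂ (s , eq) = odd  s (trans (sym (ℕP.m+[n∸m]≡n (ℕP.≮⇒≥ j≮k))) (cong (k ℕ.+_) eq))

F-below : ∀ {j k} → j ℕ.< k → F j k ≡ 0ℚ
F-below j<k rewrite >⇒≤ᵇ≡false j<k = refl

[s+s]%2≡0 : ∀ s → (s ℕ.+ s) ℕ.% 2 ≡ 0
[s+s]%2≡0 s = trans (cong (ℕ._% 2) (s+s≡s*2 s)) (m*n%n≡0 s 2)
  where
  s+s≡s*2 : ∀ s → s ℕ.+ s ≡ s ℕ.* 2
  s+s≡s*2 = solve-∀

[1+s+s]%2≡1 : ∀ s → suc (s ℕ.+ s) ℕ.% 2 ≡ 1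
[1+s+s]%2≡1 s = trans (cong (ℕ._% 2) (index s)) ([m+kn]%n≡m%n 1 s 2)
  where
  index : ∀ s → suc (s ℕ.+ s) ≡ 1 ℕ.+ s ℕ.* 2
  index = solve-∀

[s+s]/2≡s : ∀ s → (s ℕ.+ s) ℕ./ 2 ≡ s
[s+s]/2≡s s = trans (cong (ℕ._/ 2) (s+s≡s*2 s)) (m*n/n≡m s 2)
  where
  s+s≡s*2 : ∀ s → s ℕ.+ s ≡ s ℕ.* 2
  s+s≡s*2 = solve-∀

2k+2s+2≡ : ∀ k s → k ℕ.+ (s ℕ.+ s) ℕ.+ k ℕ.+ 2 ≡ suc (suc (k ℕ.+ (s ℕ.+ s) ℕ.+ k))
2k+2s+2≡ = solve-∀

[2k+2s+2]/2≡k+s+1 : ∀ k s → (k ℕ.+ (s ℕ.+ s) ℕ.+ k ℕ.+ 2) ℕ./ 2 ≡ suc (k ℕ.+ s)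
[2k+2s+2]/2≡k+s+1 k s = trans (cong (ℕ._/ 2) (index k s)) (m*n/n≡m (suc (k ℕ.+ s)) 2)
  where
  index : ∀ k s → k ℕ.+ (s ℕ.+ s) ℕ.+ k ℕ.+ 2 ≡ suc (k ℕ.+ s) ℕ.* 2
  index = solve-∀

F-odd : ∀ {j} k s → j ≡ k ℕ.+ suc (s ℕ.+ s) → F j k ≡ 0ℚ
F-odd k s refl rewrite ≤⇒≤ᵇ≡true (ℕP.m≤m+n k (suc (s ℕ.+ s))) | ℕP.m+n∸m≡n k (suc (s ℕ.+ s)) | [1+s+s]%2≡1 s = refl

F-even : ∀ {j} k s → j ≡ k ℕ.+ (s ℕ.+ s) → F j k ≡ frac (Fnum k s) (Fden k s)
F-even k s refl rewrite ≤⇒≤ᵇ≡true (ℕP.m≤m+n k (s ℕ.+ s)) | ℕP.m+n∸m≡n k (s ℕ.+ s)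
                 | [s+s]%2≡0 s | [s+s]/2≡s s | [2k+2s+2]/2≡k+s+1 k s | 2k+2s+2≡ k s = refl

Fnum-sucˡ : ∀ k s → Fnum (suc k) s ≡ suc (k ℕ.+ (s ℕ.+ s)) ℕ.* suc (suc (k ℕ.+ s)) ℕ.* Fnum k s
Fnum-sucˡ k s = regroup (suc (k ℕ.+ (s ℕ.+ s))) (suc (suc (k ℕ.+ s))) ((k ℕ.+ (s ℕ.+ s)) !) ((suc (k ℕ.+ s)) !)
  where
  regroup : ∀ a b A B → a ℕ.* A ℕ.* (b ℕ.* B) ≡ a ℕ.* b ℕ.* (A ℕ.* B)
  regroup = solve-∀

Fnum-sucʳ : ∀ k s → Fnum k (suc s) ≡ suc (suc (k ℕ.+ (s ℕ.+ s))) ℕ.* suc (k ℕ.+ (s ℕ.+ s)) ℕ.* suc (suc (k ℕ.+ s)) ℕ.* Fnum k s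
Fnum-sucʳ k s = trans (cong₂ (λ a b → a ! ℕ.* b !) (index₁ k s) (index₂ k s))
  (regroup (suc (suc (k ℕ.+ (s ℕ.+ s)))) (suc (k ℕ.+ (s ℕ.+ s))) (suc (suc (k ℕ.+ s))) ((k ℕ.+ (s ℕ.+ s)) !) ((suc (k ℕ.+ s)) !))
  where
  index₁ : ∀ k s → k ℕ.+ (suc s ℕ.+ suc s) ≡ suc (suc (k ℕ.+ (s ℕ.+ s)))
  index₁ = solve-∀
  index₂ : ∀ k s → suc (k ℕ.+ suc s) ≡ suc (suc (k ℕ.+ s))
  index₂ = solve-∀
  regroup : ∀ a b c A B → a ℕ.* (b ℕ.* A) ℕ.* (c ℕ.* B) ≡ a ℕ.* b ℕ.* c ℕ.* (A ℕ.* B)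
  regroup = solve-∀

Fden-sucˡ : ∀ k s → Fden (suc k) s ≡ (4 ℕ.+ (k ℕ.+ (s ℕ.+ s) ℕ.+ k)) ℕ.* (3 ℕ.+ (k ℕ.+ (s ℕ.+ s) ℕ.+ k)) ℕ.* Fden k s
Fden-sucˡ k s = trans (cong (λ a → s ! ℕ.* a !) (index k s))
  (regroup (4 ℕ.+ (k ℕ.+ (s ℕ.+ s) ℕ.+ k)) (3 ℕ.+ (k ℕ.+ (s ℕ.+ s) ℕ.+ k)) (s !) ((suc (suc (k ℕ.+ (s ℕ.+ s) ℕ.+ k))) !))
  where
  index : ∀ k s → suc (suc (suc k ℕ.+ (s ℕ.+ s) ℕ.+ suc k)) ≡ 4 ℕ.+ (k ℕ.+ (s ℕ.+ s) ℕ.+ k)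
  index = solve-∀
  regroup : ∀ a b S G → S ℕ.* (a ℕ.* (b ℕ.* G)) ≡ a ℕ.* b ℕ.* (S ℕ.* G)
  regroup = solve-∀

Fden-sucʳ : ∀ k s → Fden k (suc s) ≡ suc s ℕ.* (4 ℕ.+ (k ℕ.+ (s ℕ.+ s) ℕ.+ k)) ℕ.* (3 ℕ.+ (k ℕ.+ (s ℕ.+ s) ℕ.+ k)) ℕ.* Fden k s
Fden-sucʳ k s = trans (cong (λ a → suc s ! ℕ.* a !) (index k s))
  (regroup (suc s) (4 ℕ.+ (k ℕ.+ (s ℕ.+ s) ℕ.+ k)) (3 ℕ.+ (k ℕ.+ (s ℕ.+ s) ℕ.+ k)) (s !) ((suc (suc (k ℕ.+ (s ℕ.+ s) ℕ.+ k))) !))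
  where
  index : ∀ k s → suc (suc (k ℕ.+ (suc s ℕ.+ suc s) ℕ.+ k)) ≡ 4 ℕ.+ (k ℕ.+ (s ℕ.+ s) ℕ.+ k)
  index = solve-∀
  regroup : ∀ c a b S G → c ℕ.* S ℕ.* (a ℕ.* (b ℕ.* G)) ≡ c ℕ.* a ℕ.* b ℕ.* (S ℕ.* G)
  regroup = solve-∀

ι*frac-cross : ∀ α β n₁ d₁ n₂ d₂ .{{_ : ℕ.NonZero d₁}} .{{_ : ℕ.NonZero d₂}} →
  α ℕ.* n₁ ℕ.* d₂ ≡ β ℕ.* n₂ ℕ.* d₁ → ι α * frac n₁ d₁ ≡ ι β * frac n₂ d₂
ι*frac-cross α β n₁ d₁ n₂ d₂ eq = *ι-cancelʳ d₁ (*ι-cancelʳ d₂ (begin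
  ι α * frac n₁ d₁ * ι d₁ * ι d₂     ≡⟨ cong (_* ι d₂) (trans (*-assoc (ι α) (frac n₁ d₁) (ι d₁)) (cong (ι α *_) (frac-*-ι n₁ d₁))) ⟩
  ι α * ι n₁ * ι d₂                  ≡⟨ ι-homo-*₃ α n₁ d₂ ⟨
  ι (α ℕ.* n₁ ℕ.* d₂)                ≡⟨ cong ι eq ⟩
  ι (β ℕ.* n₂ ℕ.* d₁)                ≡⟨ ι-homo-*₃ β n₂ d₁ ⟩
  ι β * ι n₂ * ι d₁                  ≡⟨ cong (λ t → ι β * t * ι d₁) (frac-*-ι n₂ d₂) ⟨
  ι β * (frac n₂ d₂ * ι d₂) * ι d₁   ≡⟨ regroup (ι β) (frac n₂ d₂) (ι d₂) (ι d₁) ⟩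
  ι β * frac n₂ d₂ * ι d₁ * ι d₂     ∎))
  where
  regroup : ∀ b f u v → b * (f * u) * v ≡ b * f * v * u
  regroup = ring-solve-∀ ℚ-ring

*0≡*0 : ∀ a b {p q} → p ≡ 0ℚ → q ≡ 0ℚ → a * p ≡ b * q
*0≡*0 a b refl refl = trans (*-zeroʳ a) (sym (*-zeroʳ b))

Fnum-Fden-diagonal : ∀ k s →
  suc (k ℕ.+ (s ℕ.+ s)) ℕ.* Fnum k s ℕ.* Fden (suc k) s ≡ 2 ℕ.* (k ℕ.+ (s ℕ.+ s) ℕ.+ k ℕ.+ 3) ℕ.* Fnum (suc k) s ℕ.* Fden k s
Fnum-Fden-diagonal k s = begin
  suc (k ℕ.+ (s ℕ.+ s)) ℕ.* Fnum k s ℕ.* Fden (suc k) s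
    ≡⟨ cong (suc (k ℕ.+ (s ℕ.+ s)) ℕ.* Fnum k s ℕ.*_) (Fden-sucˡ k s) ⟩
  suc (k ℕ.+ (s ℕ.+ s)) ℕ.* Fnum k s ℕ.* ((4 ℕ.+ (k ℕ.+ (s ℕ.+ s) ℕ.+ k)) ℕ.* (3 ℕ.+ (k ℕ.+ (s ℕ.+ s) ℕ.+ k)) ℕ.* Fden k s)
    ≡⟨ identity k s (Fnum k s) (Fden k s) ⟩
  2 ℕ.* (k ℕ.+ (s ℕ.+ s) ℕ.+ k ℕ.+ 3) ℕ.* (suc (k ℕ.+ (s ℕ.+ s)) ℕ.* suc (suc (k ℕ.+ s)) ℕ.* Fnum k s) ℕ.* Fden k s
    ≡⟨ cong (λ n → 2 ℕ.* (k ℕ.+ (s ℕ.+ s) ℕ.+ k ℕ.+ 3) ℕ.* n ℕ.* Fden k s) (Fnum-sucˡ k s) ⟨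
  2 ℕ.* (k ℕ.+ (s ℕ.+ s) ℕ.+ k ℕ.+ 3) ℕ.* Fnum (suc k) s ℕ.* Fden k s ∎
  where
  identity : ∀ k s N D →
    suc (k ℕ.+ (s ℕ.+ s)) ℕ.* N ℕ.* ((4 ℕ.+ (k ℕ.+ (s ℕ.+ s) ℕ.+ k)) ℕ.* (3 ℕ.+ (k ℕ.+ (s ℕ.+ s) ℕ.+ k)) ℕ.* D)
      ≡ 2 ℕ.* (k ℕ.+ (s ℕ.+ s) ℕ.+ k ℕ.+ 3) ℕ.* (suc (k ℕ.+ (s ℕ.+ s)) ℕ.* suc (suc (k ℕ.+ s)) ℕ.* N) ℕ.* D
  identity = solve-∀

Fnum-Fden-exchange : ∀ k s →
  2 ℕ.* suc (suc k ℕ.+ (s ℕ.+ s)) ℕ.* Fnum (suc k) s ℕ.* Fden k (suc s) ≡ (suc s ℕ.+ suc s) ℕ.* Fnum k (suc s) ℕ.* Fden (suc k) s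
Fnum-Fden-exchange k s = begin
  2 ℕ.* suc (suc k ℕ.+ (s ℕ.+ s)) ℕ.* Fnum (suc k) s ℕ.* Fden k (suc s)
    ≡⟨ cong₂ (λ n d → 2 ℕ.* suc (suc k ℕ.+ (s ℕ.+ s)) ℕ.* n ℕ.* d) (Fnum-sucˡ k s) (Fden-sucʳ k s) ⟩
  2 ℕ.* suc (suc k ℕ.+ (s ℕ.+ s)) ℕ.* (suc (k ℕ.+ (s ℕ.+ s)) ℕ.* suc (suc (k ℕ.+ s)) ℕ.* Fnum k s) ℕ.* (suc s ℕ.* X₄ ℕ.* X₃ ℕ.* Fden k s)
    ≡⟨ identity k s (Fnum k s) (Fden k s) ⟩
  (suc s ℕ.+ suc s) ℕ.* (suc (suc (k ℕ.+ (s ℕ.+ s))) ℕ.* suc (k ℕ.+ (s ℕ.+ s)) ℕ.* suc (suc (k ℕ.+ s)) ℕ.* Fnum k s) ℕ.* (X₄ ℕ.* X₃ ℕ.* Fden k s)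
    ≡⟨ cong₂ (λ n d → (suc s ℕ.+ suc s) ℕ.* n ℕ.* d) (Fnum-sucʳ k s) (Fden-sucˡ k s) ⟨
  (suc s ℕ.+ suc s) ℕ.* Fnum k (suc s) ℕ.* Fden (suc k) s ∎
  where
  X₄ = 4 ℕ.+ (k ℕ.+ (s ℕ.+ s) ℕ.+ k)
  X₃ = 3 ℕ.+ (k ℕ.+ (s ℕ.+ s) ℕ.+ k)
  identity : ∀ k s N D →
    2 ℕ.* suc (suc k ℕ.+ (s ℕ.+ s)) ℕ.* (suc (k ℕ.+ (s ℕ.+ s)) ℕ.* suc (suc (k ℕ.+ s)) ℕ.* N)
      ℕ.* (suc s ℕ.* (4 ℕ.+ (k ℕ.+ (s ℕ.+ s) ℕ.+ k)) ℕ.* (3 ℕ.+ (k ℕ.+ (s ℕ.+ s) ℕ.+ k)) ℕ.* D)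
    ≡ (suc s ℕ.+ suc s) ℕ.* (suc (suc (k ℕ.+ (s ℕ.+ s))) ℕ.* suc (k ℕ.+ (s ℕ.+ s)) ℕ.* suc (suc (k ℕ.+ s)) ℕ.* N)
      ℕ.* ((4 ℕ.+ (k ℕ.+ (s ℕ.+ s) ℕ.+ k)) ℕ.* (3 ℕ.+ (k ℕ.+ (s ℕ.+ s) ℕ.+ k)) ℕ.* D)
  identity = solve-∀

F-diagonal-step : ∀ j k → ι (suc j) * F j k ≡ ι (2 ℕ.* (j ℕ.+ k ℕ.+ 3)) * F (suc j) (suc k)
F-diagonal-step j k = F-diagonal-step-by j k (offset k j)
  where
  F-diagonal-step-by : ∀ j k → Offset k j → ι (suc j) * F j k ≡ ι (2 ℕ.* (j ℕ.+ k ℕ.+ 3)) * F (suc j) (suc k)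
  F-diagonal-step-by j k (below j<k) = *0≡*0 (ι (suc j)) (ι (2 ℕ.* (j ℕ.+ k ℕ.+ 3))) (F-below j<k) (F-below (s≤s j<k))
  F-diagonal-step-by _ k (odd s refl) = *0≡*0 (ι (suc (k ℕ.+ suc (s ℕ.+ s)))) (ι (2 ℕ.* (k ℕ.+ suc (s ℕ.+ s) ℕ.+ k ℕ.+ 3))) (F-odd k s refl) (F-odd (suc k) s refl)
  F-diagonal-step-by _ k (even s refl) =
    trans (cong (ι (suc (k ℕ.+ (s ℕ.+ s))) *_) (F-even k s refl))
    (trans (ι*frac-cross (suc (k ℕ.+ (s ℕ.+ s))) (2 ℕ.* (k ℕ.+ (s ℕ.+ s) ℕ.+ k ℕ.+ 3))
                         (Fnum k s) (Fden k s) (Fnum (suc k) s) (Fden (suc k) s)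
                         {{Fden-nonZero k s}} {{Fden-nonZero (suc k) s}} (Fnum-Fden-diagonal k s))
      (cong (ι (2 ℕ.* (k ℕ.+ (s ℕ.+ s) ℕ.+ k ℕ.+ 3)) *_) (sym (F-even (suc k) s refl))))

F-exchange-below : ∀ j k → j ℕ.≤ k → ι (suc j ∸ k) * F (suc j) k ≡ 0ℚ
F-exchange-below j k j≤k = [
  (λ j<k → trans (cong (λ d → ι d * F (suc j) k) (ℕP.m≤n⇒m∸n≡0 j<k)) (*-zeroˡ (F (suc j) k))) ,
  (λ j≡k → trans (cong (ι (suc j ∸ k) *_) (F-odd k 0 (trans (cong suc j≡k) (ℕP.+-comm 1 k)))) (*-zeroʳ (ι (suc j ∸ k)))) ]′
  (ℕP.m≤n⇒m<n∨m≡n j≤k)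

F-exchange : ∀ j k → ι (2 ℕ.* suc j) * F j (suc k) ≡ ι (suc j ∸ k) * F (suc j) k
F-exchange j k = F-exchange-by j k (offset (suc k) j)
  where
  index : ∀ k s → suc (suc k ℕ.+ (s ℕ.+ s)) ≡ k ℕ.+ (suc s ℕ.+ suc s)
  index = solve-∀
  F-exchange-by : ∀ j k → Offset (suc k) j → ι (2 ℕ.* suc j) * F j (suc k) ≡ ι (suc j ∸ k) * F (suc j) k
  F-exchange-by j k (below j≤k) =
    trans (trans (cong (ι (2 ℕ.* suc j) *_) (F-below j≤k)) (*-zeroʳ (ι (2 ℕ.* suc j)))) (sym (F-exchange-below j k (ℕP.≤-pred j≤k)))
  F-exchange-by _ k (odd s refl) = *0≡*0 (ι (2 ℕ.* suc (suc k ℕ.+ suc (s ℕ.+ s)))) (ι (suc (suc k ℕ.+ suc (s ℕ.+ s)) ∸ k)) (F-odd (suc k) s refl) (F-odd k (suc s) (index′ k s))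
    where
    index′ : ∀ k s → suc (suc k ℕ.+ suc (s ℕ.+ s)) ≡ k ℕ.+ suc (suc s ℕ.+ suc s)
    index′ = solve-∀
  F-exchange-by _ k (even s refl) =
    trans (cong (ι (2 ℕ.* suc (suc k ℕ.+ (s ℕ.+ s))) *_) (F-even (suc k) s refl))
    (trans (ι*frac-cross (2 ℕ.* suc (suc k ℕ.+ (s ℕ.+ s))) (suc s ℕ.+ suc s)
                         (Fnum (suc k) s) (Fden (suc k) s) (Fnum k (suc s)) (Fden k (suc s))
                         {{Fden-nonZero (suc k) s}} {{Fden-nonZero k (suc s)}} (Fnum-Fden-exchange k s))
      (cong₂ (λ d f → ι d * f) (sym (trans (cong (_∸ k) (index k s)) (ℕP.m+n∸m≡n k (suc s ℕ.+ suc s)))) (sym (F-even k (suc s) (index k s)))))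

ι*X*ι≡ι[*]*X : ∀ a b X → ι a * X * ι b ≡ ι (a ℕ.* b) * X
ι*X*ι≡ι[*]*X a b X = trans (swap (ι a) X (ι b)) (cong (_* X) (sym (ι-homo-* a b)))
  where
  swap : ∀ u X v → u * X * v ≡ u * v * X
  swap = ring-solve-∀ ℚ-ring

ι*X+ι*[ι*X]≡ι[+*]*X : ∀ a b c X → ι a * X + ι b * (ι c * X) ≡ ι (a ℕ.+ b ℕ.* c) * X
ι*X+ι*[ι*X]≡ι[+*]*X a b c X = begin
  ι a * X + ι b * (ι c * X)       ≡⟨ cong (ι a * X +_) (sym (*-assoc (ι b) (ι c) X)) ⟩
  ι a * X + ι b * ι c * X         ≡⟨ cong (λ t → ι a * X + t * X) (ι-homo-* b c) ⟨
  ι a * X + ι (b ℕ.* c) * X       ≡⟨ *-distribʳ-+ X (ι a) (ι (b ℕ.* c)) ⟨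
  (ι a + ι (b ℕ.* c)) * X         ≡⟨ cong (_* X) (ι-homo-+ a (b ℕ.* c)) ⟨
  ι (a ℕ.+ b ℕ.* c) * X           ∎

F-recurrence-rescale : ∀ j k F₁ F₂ → (ι k * F₁ + ι (4 ℕ.* suc k) * F₂) * ι (suc j)
                                   ≡ ι k * (ι (suc j) * F₁) + ι (2 ℕ.* suc k) * (ι (2 ℕ.* suc j) * F₂)
F-recurrence-rescale j k F₁ F₂ = begin
  (ι k * F₁ + ι (4 ℕ.* suc k) * F₂) * ι (suc j)
    ≡⟨ cong (λ c → (ι k * F₁ + c * F₂) * ι (suc j)) (ι-homo-* 4 (suc k)) ⟩
  (ι k * F₁ + ι 4 * ι (suc k) * F₂) * ι (suc j)
    ≡⟨ rearrange (ι k) F₁ (ι (suc k)) F₂ (ι (suc j)) ⟩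
  ι k * (ι (suc j) * F₁) + ι 2 * ι (suc k) * (ι 2 * ι (suc j) * F₂)
    ≡⟨ cong₂ (λ u v → ι k * (ι (suc j) * F₁) + u * (v * F₂)) (ι-homo-* 2 (suc k)) (ι-homo-* 2 (suc j)) ⟨
  ι k * (ι (suc j) * F₁) + ι (2 ℕ.* suc k) * (ι (2 ℕ.* suc j) * F₂) ∎
  where
  rearrange : ∀ a F₁ c F₂ b → (a * F₁ + ι 4 * c * F₂) * b ≡ a * (b * F₁) + ι 2 * c * (ι 2 * b * F₂)
  rearrange = ring-solve-∀ ℚ-ring

-- The coefficient that F-diagonal-step produces from the term k F j (k − 1).
diagonalWeight : ℕ → ℕ → ℕ
diagonalWeight j zero    = 0
diagonalWeight j (suc k) = suc k ℕ.* (2 ℕ.* (j ℕ.+ k ℕ.+ 3))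

F-diagonal-term : ∀ j k → ι k * (ι (suc j) * F j (k ∸ 1)) ≡ ι (diagonalWeight j k) * F (suc j) k
F-diagonal-term j zero    = trans (*-zeroˡ (ι (suc j) * F j (0 ∸ 1))) (sym (*-zeroˡ (F (suc j) 0)))
F-diagonal-term j (suc k) = begin
  ι (suc k) * (ι (suc j) * F j k)                                ≡⟨ cong (ι (suc k) *_) (F-diagonal-step j k) ⟩
  ι (suc k) * (ι (2 ℕ.* (j ℕ.+ k ℕ.+ 3)) * F (suc j) (suc k))     ≡⟨ *-assoc (ι (suc k)) (ι (2 ℕ.* (j ℕ.+ k ℕ.+ 3))) (F (suc j) (suc k)) ⟨
  ι (suc k) * ι (2 ℕ.* (j ℕ.+ k ℕ.+ 3)) * F (suc j) (suc k)       ≡⟨ cong (_* F (suc j) (suc k)) (ι-homo-* (suc k) (2 ℕ.* (j ℕ.+ k ℕ.+ 3))) ⟨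
  ι (diagonalWeight j (suc k)) * F (suc j) (suc k)               ∎

F-recurrence-weights : ∀ j k → k ℕ.≤ suc j →
  diagonalWeight j k ℕ.+ 2 ℕ.* suc k ℕ.* (suc j ∸ k) ≡ 2 ℕ.* suc (2 ℕ.* k) ℕ.* suc j
F-recurrence-weights j zero    _         = identity j
  where
  identity : ∀ j → 0 ℕ.+ 2 ℕ.* 1 ℕ.* suc j ≡ 2 ℕ.* suc (2 ℕ.* 0) ℕ.* suc j
  identity = solve-∀
F-recurrence-weights j (suc k) (s≤s k≤j) = begin
  suc k ℕ.* (2 ℕ.* (j ℕ.+ k ℕ.+ 3)) ℕ.+ 2 ℕ.* suc (suc k) ℕ.* (j ∸ k)
    ≡⟨ cong (λ i → suc k ℕ.* (2 ℕ.* (i ℕ.+ k ℕ.+ 3)) ℕ.+ 2 ℕ.* suc (suc k) ℕ.* (i ∸ k)) (sym k+d≡j) ⟩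
  suc k ℕ.* (2 ℕ.* (k ℕ.+ d ℕ.+ k ℕ.+ 3)) ℕ.+ 2 ℕ.* suc (suc k) ℕ.* (k ℕ.+ d ∸ k)
    ≡⟨ cong (λ e → suc k ℕ.* (2 ℕ.* (k ℕ.+ d ℕ.+ k ℕ.+ 3)) ℕ.+ 2 ℕ.* suc (suc k) ℕ.* e) (ℕP.m+n∸m≡n k d) ⟩
  suc k ℕ.* (2 ℕ.* (k ℕ.+ d ℕ.+ k ℕ.+ 3)) ℕ.+ 2 ℕ.* suc (suc k) ℕ.* d
    ≡⟨ identity k d ⟩
  2 ℕ.* suc (2 ℕ.* suc k) ℕ.* suc (k ℕ.+ d)
    ≡⟨ cong (λ i → 2 ℕ.* suc (2 ℕ.* suc k) ℕ.* suc i) k+d≡j ⟩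
  2 ℕ.* suc (2 ℕ.* suc k) ℕ.* suc j ∎
  where
  d = proj₁ (ℕP.m≤n⇒∃[o]m+o≡n k≤j)
  k+d≡j = proj₂ (ℕP.m≤n⇒∃[o]m+o≡n k≤j)
  identity : ∀ k d → suc k ℕ.* (2 ℕ.* (k ℕ.+ d ℕ.+ k ℕ.+ 3)) ℕ.+ 2 ℕ.* suc (suc k) ℕ.* d ≡ 2 ℕ.* suc (2 ℕ.* suc k) ℕ.* suc (k ℕ.+ d)
  identity = solve-∀

-- Multiplying by j + 1 turns both neighbours into multiples of F (j + 1) k.
F-recurrence-within : ∀ j k → k ℕ.≤ suc j →
  ι (2 ℕ.* suc (2 ℕ.* k)) * F (suc j) k ≡ ι k * F j (k ∸ 1) + ι (4 ℕ.* suc k) * F j (suc k)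
F-recurrence-within j k k≤1+j = *ι-cancelʳ (suc j) (begin
  ι (2 ℕ.* suc (2 ℕ.* k)) * F (suc j) k * ι (suc j)
    ≡⟨ ι*X*ι≡ι[*]*X (2 ℕ.* suc (2 ℕ.* k)) (suc j) (F (suc j) k) ⟩
  ι (2 ℕ.* suc (2 ℕ.* k) ℕ.* suc j) * F (suc j) k
    ≡⟨ cong (λ m → ι m * F (suc j) k) (F-recurrence-weights j k k≤1+j) ⟨
  ι (diagonalWeight j k ℕ.+ 2 ℕ.* suc k ℕ.* (suc j ∸ k)) * F (suc j) k
    ≡⟨ ι*X+ι*[ι*X]≡ι[+*]*X (diagonalWeight j k) (2 ℕ.* suc k) (suc j ∸ k) (F (suc j) k) ⟨
  ι (diagonalWeight j k) * F (suc j) k + ι (2 ℕ.* suc k) * (ι (suc j ∸ k) * F (suc j) k)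
    ≡⟨ cong₂ (λ u v → u + ι (2 ℕ.* suc k) * v) (sym (F-diagonal-term j k)) (sym (F-exchange j k)) ⟩
  ι k * (ι (suc j) * F j (k ∸ 1)) + ι (2 ℕ.* suc k) * (ι (2 ℕ.* suc j) * F j (suc k))
    ≡⟨ F-recurrence-rescale j k (F j (k ∸ 1)) (F j (suc k)) ⟨
  (ι k * F j (k ∸ 1) + ι (4 ℕ.* suc k) * F j (suc k)) * ι (suc j) ∎)

F-recurrence-beyond : ∀ j k → suc j ℕ.< k →
  ι (2 ℕ.* suc (2 ℕ.* k)) * F (suc j) k ≡ ι k * F j (k ∸ 1) + ι (4 ℕ.* suc k) * F j (suc k)
F-recurrence-beyond j k 1+j<k = begin
  ι (2 ℕ.* suc (2 ℕ.* k)) * F (suc j) k                ≡⟨ *0≡*0 (ι (2 ℕ.* suc (2 ℕ.* k))) (ι k) (F-below 1+j<k) (F-below (ℕP.∸-monoˡ-≤ 1 1+j<k)) ⟩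
  ι k * F j (k ∸ 1)                                    ≡⟨ +-identityʳ (ι k * F j (k ∸ 1)) ⟨
  ι k * F j (k ∸ 1) + 0ℚ                               ≡⟨ cong (ι k * F j (k ∸ 1) +_) (sym (trans (cong (ι (4 ℕ.* suc k) *_) (F-below j<1+k)) (*-zeroʳ (ι (4 ℕ.* suc k))))) ⟩
  ι k * F j (k ∸ 1) + ι (4 ℕ.* suc k) * F j (suc k)    ∎
  where
  j<1+k = ℕP.m<n⇒m<1+n (ℕP.<-trans (ℕP.n<1+n j) 1+j<k)

F-recurrence : ∀ j k → ι (2 ℕ.* suc (2 ℕ.* k)) * F (suc j) k ≡ ι k * F j (k ∸ 1) + ι (4 ℕ.* suc k) * F j (suc k)
F-recurrence j k = [ F-recurrence-within j k , F-recurrence-beyond j k ]′ (ℕP.≤-<-connex k (suc j))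

-- The inverse expansion xʲ = Σₖ wₖ F j k Pₖ(x)

weight : ℕ → ℕ
weight k = 2 ℕ.^ (k ℕ.+ 2) ℕ.* k ℕ.+ 2 ℕ.^ (k ℕ.+ 1)

ι-weight : ∀ k → ι (weight k) ≡ ι (2 ℕ.^ k) * ι (2 ℕ.* suc (2 ℕ.* k))
ι-weight k = trans (cong ι (trans (cong₂ (λ a b → a ℕ.* k ℕ.+ b) (ℕP.^-distribˡ-+-* 2 k 2) (ℕP.^-distribˡ-+-* 2 k 1)) (factor (2 ℕ.^ k) k)))
  (ι-homo-* (2 ℕ.^ k) (2 ℕ.* suc (2 ℕ.* k)))
  where
  factor : ∀ p k → p ℕ.* 4 ℕ.* k ℕ.+ p ℕ.* 2 ≡ p ℕ.* (2 ℕ.* suc (2 ℕ.* k))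
  factor = solve-∀

ι-weight′ : ∀ k → ι (weight k) ≡ ι (2 ℕ.^ suc k) * ι (suc (2 ℕ.* k))
ι-weight′ k = trans (ι-weight k) (trans (cong (ι (2 ℕ.^ k) *_) (ι-homo-* 2 (suc (2 ℕ.* k))))
  (trans (regroup (ι (2 ℕ.^ k)) (ι 2) (ι (suc (2 ℕ.* k)))) (cong (_* ι (suc (2 ℕ.* k))) (sym (ι-homo-* 2 (2 ℕ.^ k))))))
  where
  regroup : ∀ p t c → p * (t * c) ≡ t * p * c
  regroup = ring-solve-∀ ℚ-ring

weight*F-split : ∀ x j k → ι (weight k) * F (suc j) k * P k x
  ≡ ι (2 ℕ.^ k) * ι k * F j (k ∸ 1) * P k x + ι (2 ℕ.^ k) * ι (4 ℕ.* suc k) * F j (suc k) * P k x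
weight*F-split x j k = begin
  ι (weight k) * F (suc j) k * P k x                                         ≡⟨ cong (λ w → w * F (suc j) k * P k x) (ι-weight k) ⟩
  ι (2 ℕ.^ k) * ι (2 ℕ.* suc (2 ℕ.* k)) * F (suc j) k * P k x                  ≡⟨ assoc (ι (2 ℕ.^ k)) (ι (2 ℕ.* suc (2 ℕ.* k))) (F (suc j) k) (P k x) ⟩
  ι (2 ℕ.^ k) * (ι (2 ℕ.* suc (2 ℕ.* k)) * F (suc j) k) * P k x                ≡⟨ cong (λ t → ι (2 ℕ.^ k) * t * P k x) (F-recurrence j k) ⟩
  ι (2 ℕ.^ k) * (ι k * F j (k ∸ 1) + ι (4 ℕ.* suc k) * F j (suc k)) * P k x     ≡⟨ distrib (ι (2 ℕ.^ k)) (ι k) (F j (k ∸ 1)) (ι (4 ℕ.* suc k)) (F j (suc k)) (P k x) ⟩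
  ι (2 ℕ.^ k) * ι k * F j (k ∸ 1) * P k x + ι (2 ℕ.^ k) * ι (4 ℕ.* suc k) * F j (suc k) * P k x ∎
  where
  assoc : ∀ p c f q → p * c * f * q ≡ p * (c * f) * q
  assoc = ring-solve-∀ ℚ-ring
  distrib : ∀ p u f v g q → p * (u * f + v * g) * q ≡ p * u * f * q + p * v * g * q
  distrib = ring-solve-∀ ℚ-ring

weight*F-bonnet : ∀ x j k → ι (2 ℕ.^ suc k) * ι (suc k) * F j k * P (suc k) x + ι (2 ℕ.^ suc k) * ι k * F j k * P (k ∸ 1) x
  ≡ x * (ι (weight k) * F j k * P k x)
weight*F-bonnet x j k = begin
  ι (2 ℕ.^ suc k) * ι (suc k) * F j k * P (suc k) x + ι (2 ℕ.^ suc k) * ι k * F j k * P (k ∸ 1) x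
    ≡⟨ factor (ι (2 ℕ.^ suc k)) (ι (suc k)) (F j k) (P (suc k) x) (ι k) (P (k ∸ 1) x) ⟩
  ι (2 ℕ.^ suc k) * F j k * (ι (suc k) * P (suc k) x + ι k * P (k ∸ 1) x)
    ≡⟨ cong (ι (2 ℕ.^ suc k) * F j k *_) (P-recurrence x k) ⟩
  ι (2 ℕ.^ suc k) * F j k * (ι (suc (2 ℕ.* k)) * x * P k x)
    ≡⟨ reorder (ι (2 ℕ.^ suc k)) (F j k) (ι (suc (2 ℕ.* k))) x (P k x) ⟩
  x * (ι (2 ℕ.^ suc k) * ι (suc (2 ℕ.* k)) * F j k * P k x)
    ≡⟨ cong (λ w → x * (w * F j k * P k x)) (ι-weight′ k) ⟨
  x * (ι (weight k) * F j k * P k x) ∎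
  where
  factor : ∀ p c f q d r → p * c * f * q + p * d * f * r ≡ p * f * (c * q + d * r)
  factor = ring-solve-∀ ℚ-ring
  reorder : ∀ p f c y q → p * f * (c * y * q) ≡ y * (p * c * f * q)
  reorder = ring-solve-∀ ℚ-ring

monomial-expansion : ∀ x j N → j ℕ.< N → Σ< N (λ k → ι (weight k) * F j k * P k x) ≡ x ^ℚ j
monomial-expansion x zero    (suc N) _ = begin
  Σ< (suc N) (λ k → ι (weight k) * F 0 k * P k x)                ≡⟨ Σ<-head N (λ k → ι (weight k) * F 0 k * P k x) ⟩
  ι (weight 0) * F 0 0 * P 0 x + Σ< N (λ k → ι (weight (suc k)) * F 0 (suc k) * P (suc k) x)
    ≡⟨ cong (ι (weight 0) * F 0 0 * P 0 x +_) (Σ<-zero N (λ k _ → vanish k)) ⟩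
  ι (weight 0) * F 0 0 * P 0 x + 0ℚ                             ≡⟨ refl ⟩
  1ℚ                                                            ∎
  where
  vanish : ∀ k → ι (weight (suc k)) * F 0 (suc k) * P (suc k) x ≡ 0ℚ
  vanish k = trans (cong (λ f → ι (weight (suc k)) * f * P (suc k) x) (F-below {0} {suc k} (s≤s z≤n)))
    (trans (cong (_* P (suc k) x) (*-zeroʳ (ι (weight (suc k))))) (*-zeroˡ (P (suc k) x)))
monomial-expansion x (suc j) (suc N) 1+j<1+N = begin
  Σ< (suc N) (λ k → ι (weight k) * F (suc j) k * P k x)           ≡⟨ Σ<-cong′ (suc N) (weight*F-split x j) ⟩
  Σ< (suc N) (λ k → a k + b k)                                   ≡⟨ Σ<-distrib-+ (suc N) a b ⟩
  Σ< (suc N) a + Σ< (suc N) b                                    ≡⟨ cong₂ _+_ (Σ<-shift N a A a₀≡0 (λ _ → refl) Aₙ≡0)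
                                                                             (sym (Σ<-shift N B′ b B′₀≡0 b≡B′∘suc bₙ≡0)) ⟩
  Σ< (suc N) A + Σ< (suc N) B′                                   ≡⟨ Σ<-distrib-+ (suc N) A B′ ⟨
  Σ< (suc N) (λ k → A k + B′ k)                                  ≡⟨ Σ<-cong′ (suc N) (weight*F-bonnet x j) ⟩
  Σ< (suc N) (λ k → x * (ι (weight k) * F j k * P k x))          ≡⟨ *-distribˡ-Σ< (suc N) x (λ k → ι (weight k) * F j k * P k x) ⟨
  x * Σ< (suc N) (λ k → ι (weight k) * F j k * P k x)            ≡⟨ cong (x *_) (monomial-expansion x j (suc N) (ℕP.m<n⇒m<1+n j<N)) ⟩
  x * x ^ℚ j                                                     ≡⟨ *-comm x (x ^ℚ j) ⟩
  x ^ℚ suc j                                                     ∎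
  where
  j<N = ℕP.≤-pred 1+j<1+N
  a b A B′ : ℕ → ℚ
  a k  = ι (2 ℕ.^ k) * ι k * F j (k ∸ 1) * P k x
  b k  = ι (2 ℕ.^ k) * ι (4 ℕ.* suc k) * F j (suc k) * P k x
  A k  = ι (2 ℕ.^ suc k) * ι (suc k) * F j k * P (suc k) x
  B′ k = ι (2 ℕ.^ suc k) * ι k * F j k * P (k ∸ 1) x
  zero₂ : ∀ p f q → p * 0ℚ * f * q ≡ 0ℚ
  zero₂ = ring-solve-∀ ℚ-ring
  zero₃ : ∀ p c q → p * c * 0ℚ * q ≡ 0ℚ
  zero₃ = ring-solve-∀ ℚ-ring
  a₀≡0 : a 0 ≡ 0ℚ
  a₀≡0 = zero₂ (ι 1) (F j 0) (P 0 x)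
  B′₀≡0 : B′ 0 ≡ 0ℚ
  B′₀≡0 = zero₂ (ι 2) (F j 0) (P 0 x)
  Aₙ≡0 : A N ≡ 0ℚ
  Aₙ≡0 = trans (cong (λ f → ι (2 ℕ.^ suc N) * ι (suc N) * f * P (suc N) x) (F-below j<N))
    (zero₃ (ι (2 ℕ.^ suc N)) (ι (suc N)) (P (suc N) x))
  bₙ≡0 : b N ≡ 0ℚ
  bₙ≡0 = trans (cong (λ f → ι (2 ℕ.^ N) * ι (4 ℕ.* suc N) * f * P N x) (F-below (ℕP.m<n⇒m<1+n j<N)))
    (zero₃ (ι (2 ℕ.^ N)) (ι (4 ℕ.* suc N)) (P N x))
  b≡B′∘suc : ∀ k → B′ (suc k) ≡ b k
  b≡B′∘suc k = cong (λ c → c * F j (suc k) * P k x) (begin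
    ι (2 ℕ.^ suc (suc k)) * ι (suc k)            ≡⟨ ι-homo-* (2 ℕ.^ suc (suc k)) (suc k) ⟨
    ι (2 ℕ.^ suc (suc k) ℕ.* suc k)              ≡⟨ cong ι (index (2 ℕ.^ k) k) ⟩
    ι (2 ℕ.^ k ℕ.* (4 ℕ.* suc k))                ≡⟨ ι-homo-* (2 ℕ.^ k) (4 ℕ.* suc k) ⟩
    ι (2 ℕ.^ k) * ι (4 ℕ.* suc k)                ∎)
    where
    index : ∀ p k → 2 ℕ.* (2 ℕ.* p) ℕ.* suc k ≡ p ℕ.* (4 ℕ.* suc k)
    index = solve-∀

legendre-expansion : ∀ x N c →
  Σ< N (λ k → ι (weight k) * Σ< N (λ j → c j * F j k) * P k x) ≡ eval N c x
legendre-expansion x N c = begin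
  Σ< N (λ k → ι (weight k) * Σ< N (λ j → c j * F j k) * P k x)
    ≡⟨ Σ<-cong′ N (λ k → distribute k) ⟩
  Σ< N (λ k → Σ< N (λ j → c j * (ι (weight k) * F j k * P k x)))
    ≡⟨ Σ<-swap N N (λ k j → c j * (ι (weight k) * F j k * P k x)) ⟩
  Σ< N (λ j → Σ< N (λ k → c j * (ι (weight k) * F j k * P k x)))
    ≡⟨ Σ<-cong N (λ j j<N → trans (sym (*-distribˡ-Σ< N (c j) (λ k → ι (weight k) * F j k * P k x))) (cong (c j *_) (monomial-expansion x j N j<N))) ⟩
  Σ< N (λ j → c j * x ^ℚ j) ∎
  where
  distribute : ∀ k → ι (weight k) * Σ< N (λ j → c j * F j k) * P k x ≡ Σ< N (λ j → c j * (ι (weight k) * F j k * P k x))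
  distribute k = begin
    ι (weight k) * Σ< N (λ j → c j * F j k) * P k x                 ≡⟨ cong (_* P k x) (*-distribˡ-Σ< N (ι (weight k)) (λ j → c j * F j k)) ⟩
    Σ< N (λ j → ι (weight k) * (c j * F j k)) * P k x               ≡⟨ *-distribʳ-Σ< N (P k x) (λ j → ι (weight k) * (c j * F j k)) ⟩
    Σ< N (λ j → ι (weight k) * (c j * F j k) * P k x)               ≡⟨ Σ<-cong′ N (λ j → regroup (ι (weight k)) (c j) (F j k) (P k x)) ⟩
    Σ< N (λ j → c j * (ι (weight k) * F j k * P k x))               ∎
    where
    regroup : ∀ w c f p → w * (c * f) * p ≡ c * (w * f * p)
    regroup = ring-solve-∀ ℚ-ring

LHS≡eval-ΣBB : ∀ n x → LHS n x ≡ eval (suc n) (ΣBB n) x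
LHS≡eval-ΣBB n x = begin
  Σ< (suc n) (λ k → Bpoly k x * Bpoly (n ∸ k) x)             ≡⟨ Σ<-cong (suc n) product ⟩
  Σ< (suc n) (λ k → eval (suc n) (bern k ⊗ bern (n ∸ k)) x)  ≡⟨ pairing-Σ< (suc n) (suc n) (λ k → bern k ⊗ bern (n ∸ k)) (x ^ℚ_) ⟨
  eval (suc n) (ΣBB n) x                                     ∎
  where
  product : ∀ k → k ℕ.< suc n → Bpoly k x * Bpoly (n ∸ k) x ≡ eval (suc n) (bern k ⊗ bern (n ∸ k)) x
  product k k≤n = trans (cong₂ _*_ (Bpoly≡eval-bern k x) (Bpoly≡eval-bern (n ∸ k) x))
    (sym (eval-⊗ k (n ∸ k) n x (bern-Deg< k) (bern-Deg< (n ∸ k)) (ℕP.≤-reflexive (ℕP.m+[n∸m]≡n (ℕP.≤-pred k≤n)))))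

coeff≡pairing-ΣBB′ : ∀ n k → coeff n k ≡ pairing (suc n) (ΣBB′ n) (λ j → F j k)
coeff≡pairing-ΣBB′ n k = begin
  coeff n k
    ≡⟨ cong₂ (λ f s → f * s + ι (suc n) * pairing (suc n) (bern n) w) (cong (frac 2) (ℕP.+-comm n 2)) (Σ<-cong (n ∸ 1) inner) ⟩
  frac 2 (suc (suc n)) * Σ< (n ∸ 1) (λ l → c l * pairing (suc n) (bern l) w) + ι (suc n) * pairing (suc n) (bern n) w
    ≡⟨ cong (λ s → frac 2 (suc (suc n)) * s + ι (suc n) * pairing (suc n) (bern n) w)
            (trans (Σ<-cong′ (n ∸ 1) (λ l → sym (pairing-scale (suc n) (c l) (bern l) w))) (sym (pairing-Σ< (suc n) (n ∸ 1) (λ l j → c l * bern l j) w))) ⟩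
  frac 2 (suc (suc n)) * pairing (suc n) (λ j → Σ< (n ∸ 1) (λ l → c l * bern l j)) w + ι (suc n) * pairing (suc n) (bern n) w
    ≡⟨ pairing-linear (suc n) (frac 2 (suc (suc n))) (ι (suc n)) (λ j → Σ< (n ∸ 1) (λ l → c l * bern l j)) (bern n) w ⟨
  pairing (suc n) (ΣBB′ n) w ∎
  where
  w : ℕ → ℚ
  w j = F j k
  c : ℕ → ℚ
  c l = B (n ∸ l) * ι (suc (suc n) C l)
  inner : ∀ l → l ℕ.< n ∸ 1 →
    Σ< (suc l) (λ j → B (n ∸ l) * B (l ∸ j) * ι (((n ℕ.+ 2) C l) ℕ.* (l C j)) * F j k) ≡ c l * pairing (suc n) (bern l) w
  inner l l<n-1 = begin
    Σ< (suc l) (λ j → B (n ∸ l) * B (l ∸ j) * ι (((n ℕ.+ 2) C l) ℕ.* (l C j)) * F j k)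
      ≡⟨ Σ<-cong′ (suc l) term ⟩
    Σ< (suc l) (λ j → c l * (bern l j * F j k))
      ≡⟨ *-distribˡ-Σ< (suc l) (c l) (λ j → bern l j * F j k) ⟨
    c l * pairing (suc l) (bern l) w
      ≡⟨ cong (c l *_) (pairing-truncate (suc l) (suc n) (bern l) w (s≤s (ℕP.≤-trans (ℕP.<⇒≤ l<n-1) (ℕP.m∸n≤m n 1))) (bern-Deg< l)) ⟨
    c l * pairing (suc n) (bern l) w ∎
    where
    term : ∀ j → B (n ∸ l) * B (l ∸ j) * ι (((n ℕ.+ 2) C l) ℕ.* (l C j)) * F j k ≡ c l * (bern l j * F j k)
    term j = begin
      B (n ∸ l) * B (l ∸ j) * ι (((n ℕ.+ 2) C l) ℕ.* (l C j)) * F j k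
        ≡⟨ cong (λ m → B (n ∸ l) * B (l ∸ j) * ι ((m C l) ℕ.* (l C j)) * F j k) (ℕP.+-comm n 2) ⟩
      B (n ∸ l) * B (l ∸ j) * ι ((suc (suc n) C l) ℕ.* (l C j)) * F j k
        ≡⟨ cong (λ t → B (n ∸ l) * B (l ∸ j) * t * F j k) (ι-homo-* (suc (suc n) C l) (l C j)) ⟩
      B (n ∸ l) * B (l ∸ j) * (ι (suc (suc n) C l) * ι (l C j)) * F j k
        ≡⟨ regroup (B (n ∸ l)) (B (l ∸ j)) (ι (suc (suc n) C l)) (ι (l C j)) (F j k) ⟩
      c l * (bern l j * F j k) ∎
      where
      regroup : ∀ b b′ u v f → b * b′ * (u * v) * f ≡ b * u * (v * b′ * f)
      regroup = ring-solve-∀ ℚ-ring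

RHS≡eval-ΣBB′ : ∀ n x → RHS n x ≡ eval (suc n) (ΣBB′ n) x
RHS≡eval-ΣBB′ n x = trans (Σ<-cong′ (suc n) (λ k → cong (λ c → ι (weight k) * c * P k x) (coeff≡pairing-ΣBB′ n k)))
  (legendre-expansion x (suc n) (ΣBB′ n))

theorem4 : (n : ℕ) (x : ℚ) → LHS n x ≡ RHS n x
theorem4 n x = begin
  LHS n x                     ≡⟨ LHS≡eval-ΣBB n x ⟩
  eval (suc n) (ΣBB n) x      ≡⟨ pairing-cong (suc n) (x ^ℚ_) (ΣBB≡ΣBB′ n) ⟩
  eval (suc n) (ΣBB′ n) x     ≡⟨ RHS≡eval-ΣBB′ n x ⟨
  RHS n x                     ∎
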